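{- For every function $f\in\mathrm{FEXP}$ there exists a finite, confluent constructor TRS $\mathcal{R}_f$ that computes $f$ and is compatible with some exponential path order $>_{\mathsf{epo}^*}$ (induced by some admissible quasi-precedence and some safe mapping on its signature).
   Context: $\mathrm{FEXP}$ is the class of functions on binary words computable by a deterministic Turing machine in time $2^{O(n^k)}$ for some $k\in\mathbb{N}$. Binary words are represented by constructor terms built from a constant $\varepsilon$ and unary constructors $\mathsf{S}_0,\mathsf{S}_1$. Signature $\mathcal{F}=\mathcal{D}\uplus\mathcal{C}$ (defined symbols and constructors). A TRS is a constructor TRS if all left-hand sides are $g(t_1,\dots,t_n)$ with $g\in\mathcal{D}$, $t_i\in\mathcal{T}(\mathcal{C},\mathcal{V})$. $\to_{\mathsf{i}}$ is innermost rewriting; $s\to_{\mathsf{i}}^! t$ means $s\to_{\mathsf{i}}^* t$ with $t$ normal. Values: $\mathsf{Val}=\mathcal{T}(\mathcal{C},\mathcal{V})$. Given a finite set $\mathcal{N}\subseteq\mathsf{Val}$ of non-accepting patterns, $t$ is accepting if no $p\in\mathcal{N}$ matches $t$. $\mathcal{R}$ computes $R\subseteq\mathsf{Val}\times\mathsf{Val}$ if for some finite $\mathcal{N}$ and some $\mathsf{f}\in\mathcal{D}$, for all $s,t\in\mathsf{Val}$: $s\,R\,t$ iff $\mathsf{f}(s)\to_{\mathsf{i}}^! t$ and $t$ is accepting; for confluent $\mathcal{R}$ the induced function is said to be computed by $\mathcal{R}$. Exponential path order: a quasi-precedence $\succsim$ is a preorder on $\mathcal{F}$ with well-founded strict part $\succ$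 and equivalence $\sim$, admissible if $g\succ c$ for all $g\in\mathcal{D},c\in\mathcal{C}$. A safe mapping gives each $n$-ary $g$ a set $\mathsf{safe}(g)\subseteq\{1,\dots,n\}$ (others normal), all positions safe for constructors. Write $g(s_1,\dots,s_l;s_{l+1},\dots,s_{l+m})$ with normal arguments first (position order), then safe ones. $s\approx_s t$ iff $s=t$ or $s=g(s_1,\dots,s_l;s_{l+1},\dots,s_{l+m})$, $t=h(t_1,\dots,t_l;t_{l+1},\dots,t_{l+m})$, $g\sim h$, $s_i\approx_s t_i$ for all $i$. $g(s_1,\dots,s_n)\rhd_* t$ iff $s_i\rhd_* t$ or $s_i\approx_s t$ for some position $i$, normal if $g\in\mathcal{D}$. $>_{\mathsf{epo}^*}$ is the least relation such that for $s=g(s_1,\dots,s_l;s_{l+1},\dots,s_{l+m})$, $s>_{\mathsf{epo}^*}t$ if (1) $s_i\geq_{\mathsf{epo}^*}t$ for some $i$; or (2) $t=h(t_1,\dots,t_k;t_{k+1},\dots,t_{k+n})$, $g\succ h$, $s\rhd_* t_j$ ($j\le k$), $s>_{\mathsf{epo}^*}t_j$ ($j>k$); or (3) $t$ as in (2), $g\sim h$, and for some $i\le\min(l,k)$: $s_j\approx_s t_j$ ($j<i$), $s_i\rhd_* t_i$, $s\rhd_* t_j$ ($i<j\le k$), $s>_{\mathsf{epo}^*}t_j$ ($j>k$); ${\geq_{\mathsf{epo}^*}}={>_{\mathsf{epo}^*}}\cup{\approx_s}$. Compatible means $l>_{\mathsf{epo}^*}r$ for every rule. -}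

module Defs where

open import Data.Bool using (Bool; true; false; not; _∨_)
open import Data.Nat using (ℕ; zero; suc; _+_; _*_; _^_; _≤_)
open import Data.Fin using (Fin; zero; suc)
open import Data.List using (List; []; _∷_; _++_; length)
open import Data.List.Relation.Unary.All as LAll using ()
open import Data.List.Relation.Unary.Any as LAny using ()
open import Data.List.Relation.Binary.Pointwise using (Pointwise)
open import Data.List.Membership.Propositional using (_∈_)
open import Data.Vec using (Vec; []; _∷_; lookup; _[_]≔_)
open import Data.Vec.Relation.Unary.All as VAll using ()
open import Data.Vec.Relation.Unary.Any as VAny using ()
open import Data.Maybe using (Maybe; just; nothing)
open import Data.Product using (Σ; _×_; _,_; ∃)
open import Data.Sum using (_⊎_)
open import Relation.Nullary using (¬_)
open import Relation.Binary.PropositionalEquality using (_≡_; subst; sym)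
open import Relation.Binary.Construct.Closure.ReflexiveTransitive using (Star)
open import Induction.WellFounded using (WellFounded)

data Move : Set where
  left right stay : Move

-- Tape symbols: Fin (3 + nextra), where
-- zero = blank, 1 = the bit 0, 2 = the bit 1, the rest are auxiliary.
-- δ q a = nothing means: the machine halts in state q reading a.
record TM : Set where
  field
    nstates : ℕ
    nextra  : ℕ
    start   : Fin (suc nstates)
    δ       : Fin (suc nstates) → Fin (3 + nextra) →
              Maybe (Fin (suc nstates) × Fin (3 + nextra) × Move)

module _ (M : TM) where
  open TM M

  State = Fin (suc nstates)
  Sym   = Fin (3 + nextra)

  blank : Sym
  blank = zero

  bitSym : Bool → Sym
  bitSym false = suc zero
  bitSym true  = suc (suc zero)

  -- configuration: state, tape left of the head (nearest cell first),
  -- scanned symbol, tape right of the head (nearest cell first);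
  -- all cells not listed are blank.
  record Config : Set where
    constructor conf
    field
      st    : State
      lft   : List Sym
      cur   : Sym
      rgt   : List Sym

  doMove : State → List Sym → Sym → List Sym → Move → Config
  doMove q []       a rs left  = conf q [] blank (a ∷ rs)
  doMove q (l ∷ ls) a rs left  = conf q ls l (a ∷ rs)
  doMove q ls       a []       right = conf q (a ∷ ls) blank []
  doMove q ls       a (r ∷ rs) right = conf q (a ∷ ls) r rs
  doMove q ls       a rs stay  = conf q ls a rs

  step : Config → Maybe Config
  step (conf q ls a rs) with δ q a
  ... | nothing            = nothing
  ... | just (q' , b , mv) = just (doMove q' ls b rs mv)

  Halted : Config → Set
  Halted c = step c ≡ nothing

  run : ℕ → Config → Config
  run zero    c = c
  run (suc n) c with step c
  ... | nothing = c
  ... | just c' = run n c'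

  initConf : List Bool → Config
  initConf []      = conf start [] blank []
  initConf (b ∷ w) = conf start [] (bitSym b) (Data.List.map bitSym w)

  readWord : List Sym → List Bool
  readWord [] = []
  readWord (suc zero ∷ xs) = false ∷ readWord xs
  readWord (suc (suc zero) ∷ xs) = true ∷ readWord xs
  readWord (_ ∷ xs) = []

  output : Config → List Bool
  output (conf _ _ a rs) = readWord (a ∷ rs)

FEXP : (List Bool → List Bool) → Set
FEXP f = Σ TM λ M → Σ ℕ λ c → Σ ℕ λ k → ∀ (w : List Bool) →
  Σ ℕ λ t → t ≤ 2 ^ (c * (suc (length w)) ^ k)
          × Halted M (run M t (initConf M w))
          × output M (run M t (initConf M w)) ≡ f w

-- A finite signature: the constructors ε, S₀, S₁, further constructors
-- con i, and defined symbols def i.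
record Signature : Set where
  field
    ncon  : ℕ
    conAr : Fin ncon → ℕ
    ndef  : ℕ
    defAr : Fin ndef → ℕ

module _ (Sg : Signature) where
  open Signature Sg

  data FSym : Set where
    ε S₀ S₁ : FSym
    con : Fin ncon → FSym
    def : Fin ndef → FSym

  arity : FSym → ℕ
  arity ε = 0
  arity S₀ = 1
  arity S₁ = 1
  arity (con i) = conAr i
  arity (def i) = defAr i

  isDefined : FSym → Bool
  isDefined (def _) = true
  isDefined _       = false

  data Term : Set where
    var : ℕ → Term
    app : (f : FSym) → Vec Term (arity f) → Term

  enc : List Bool → Term
  enc []          = app ε []
  enc (false ∷ w) = app S₀ (enc w ∷ [])
  enc (true ∷ w)  = app S₁ (enc w ∷ [])

  Subst : Set
  Subst = ℕ → Term

  mutual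
    _⟨_⟩ : Term → Subst → Term
    var x ⟨ σ ⟩    = σ x
    app f ts ⟨ σ ⟩ = app f (substs ts σ)

    substs : ∀ {n} → Vec Term n → Subst → Vec Term n
    substs []       σ = []
    substs (t ∷ ts) σ = (t ⟨ σ ⟩) ∷ substs ts σ

  data _occursIn_ (x : ℕ) : Term → Set where
    here : x occursIn var x
    there : ∀ {f ts} → VAny.Any (x occursIn_) ts → x occursIn app f ts

  data IsValue : Term → Set where
    var : ∀ x → IsValue (var x)
    app : ∀ {f ts} → isDefined f ≡ false → VAll.All IsValue ts → IsValue (app f ts)

  record Rule : Set where
    constructor rule
    field
      fn   : FSym
      pats : Vec Term (arity fn)
      rhs  : Term
    lhs : Term
    lhs = app fn pats

  open Rule

  IsRule : Rule → Set
  IsRule ρ = ∀ x → x occursIn rhs ρ → x occursIn lhs ρ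

  IsConstructorRule : Rule → Set
  IsConstructorRule ρ = IsRule ρ × isDefined (fn ρ) ≡ true × VAll.All IsValue (pats ρ)

  ConstructorTRS : List Rule → Set
  ConstructorTRS R = LAll.All IsConstructorRule R

  module _ (R : List Rule) where

    data _⟶_ : Term → Term → Set where
      root : ∀ {ρ} → ρ ∈ R → (σ : Subst) → (lhs ρ ⟨ σ ⟩) ⟶ (rhs ρ ⟨ σ ⟩)
      cong : ∀ {f ts u} (i : Fin (arity f)) → lookup ts i ⟶ u →
             app f ts ⟶ app f (ts [ i ]≔ u)

    NF : Term → Set
    NF t = ∀ u → ¬ (t ⟶ u)

    data _⟶ᵢ_ : Term → Term → Set where
      root : ∀ {ρ} → ρ ∈ R → (σ : Subst) → VAll.All NF (substs (pats ρ) σ) →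
             (lhs ρ ⟨ σ ⟩) ⟶ᵢ (rhs ρ ⟨ σ ⟩)
      cong : ∀ {f ts u} (i : Fin (arity f)) → lookup ts i ⟶ᵢ u →
             app f ts ⟶ᵢ app f (ts [ i ]≔ u)

    _⟶*_ : Term → Term → Set
    _⟶*_ = Star _⟶_

    _⟶ᵢ*_ : Term → Term → Set
    _⟶ᵢ*_ = Star _⟶ᵢ_

    _⟶ᵢ!_ : Term → Term → Set
    s ⟶ᵢ! t = (s ⟶ᵢ* t) × NF t

    Confluent : Set
    Confluent = ∀ {s t u} → s ⟶* t → s ⟶* u → ∃ λ v → (t ⟶* v) × (u ⟶* v)

    Matches : Term → Term → Set
    Matches p t = ∃ λ (σ : Subst) → p ⟨ σ ⟩ ≡ t

    Accepting : List Term → Term → Set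
    Accepting N t = LAll.All (λ p → ¬ Matches p t) N

    app₁ : (g : Fin ndef) → defAr g ≡ 1 → Term → Term
    app₁ g e s = app (def g) (subst (Vec Term) (sym e) (s ∷ []))

    ComputesRel : (Term → Term → Set) → Set
    ComputesRel Rel =
      Σ (List Term) λ N → LAll.All IsValue N ×
      Σ (Fin ndef) λ g → Σ (defAr g ≡ 1) λ e →
        ∀ s t → IsValue s → IsValue t →
          (Rel s t → (app₁ g e s ⟶ᵢ! t) × Accepting N t) ×
          ((app₁ g e s ⟶ᵢ! t) × Accepting N t → Rel s t)

    Graph : (List Bool → List Bool) → Term → Term → Set
    Graph f s t = ∃ λ w → s ≡ enc w × t ≡ enc (f w)

    Computes : (List Bool → List Bool) → Set
    Computes f = Confluent × ComputesRel (Graph f)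

  record QuasiPrecedence : Set₁ where
    field
      _≿_     : FSym → FSym → Set
      ≿-refl  : ∀ {f} → f ≿ f
      ≿-trans : ∀ {f g h} → f ≿ g → g ≿ h → f ≿ h
    _≻_ : FSym → FSym → Set
    f ≻ g = f ≿ g × ¬ (g ≿ f)
    _∼_ : FSym → FSym → Set
    f ∼ g = f ≿ g × g ≿ f
    field
      ≻-wf : WellFounded (λ f g → g ≻ f)

  Admissible : QuasiPrecedence → Set
  Admissible P = ∀ g c → isDefined g ≡ true → isDefined c ≡ false → g ≻ c
    where open QuasiPrecedence P

  SafeMapping : Set
  SafeMapping = (g : Fin ndef) → Fin (defAr g) → Bool

  module EPO (P : QuasiPrecedence) (safe : SafeMapping) where
    open QuasiPrecedence P

    isSafe : (f : FSym) → Fin (arity f) → Bool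
    isSafe (def g) i = safe g i
    isSafe ε       i = true
    isSafe S₀      i = true
    isSafe S₁      i = true
    isSafe (con c) i = true

    select : ∀ {n} → (Fin n → Bool) → Vec Term n → List Term
    select p []       = []
    select p (t ∷ ts) with p zero
    ... | true  = t ∷ select (λ i → p (suc i)) ts
    ... | false = select (λ i → p (suc i)) ts

    nargs : (f : FSym) → Vec Term (arity f) → List Term
    nargs f ts = select (λ i → not (isSafe f i)) ts

    sargs : (f : FSym) → Vec Term (arity f) → List Term
    sargs f ts = select (isSafe f) ts

    data _≈ₛ_ : Term → Term → Set where
      refl≈ : ∀ {t} → t ≈ₛ t
      app≈  : ∀ {f g ss ts} → f ∼ g →
              Pointwise _≈ₛ_ (nargs f ss) (nargs g ts) →
              Pointwise _≈ₛ_ (sargs f ss) (sargs g ts) →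
              app f ss ≈ₛ app g ts

    descend : (f : FSym) → Fin (arity f) → Bool
    descend f i = not (isDefined f) ∨ not (isSafe f i)

    data _▷*_ : Term → Term → Set where
      sub : ∀ {f ts t} (i : Fin (arity f)) → descend f i ≡ true →
            (lookup ts i ▷* t) ⊎ (lookup ts i ≈ₛ t) → app f ts ▷* t

    data _>epo_ : Term → Term → Set where
      epo1 : ∀ {f ss t} →
             VAny.Any (λ u → (u >epo t) ⊎ (u ≈ₛ t)) ss →
             app f ss >epo t
      epo2 : ∀ {f ss g ts} → f ≻ g →
             LAll.All (λ u → app f ss ▷* u) (nargs g ts) →
             LAll.All (λ u → app f ss >epo u) (sargs g ts) →
             app f ss >epo app g ts
      epo3 : ∀ {f ss g ts} → f ∼ g →
             ∀ pre₁ a rest₁ pre₂ b rest₂ →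
             nargs f ss ≡ pre₁ ++ (a ∷ rest₁) →
             nargs g ts ≡ pre₂ ++ (b ∷ rest₂) →
             Pointwise _≈ₛ_ pre₁ pre₂ →
             a ▷* b →
             LAll.All (λ u → app f ss ▷* u) rest₂ →
             LAll.All (λ u → app f ss >epo u) (sargs g ts) →
             app f ss >epo app g ts

    Compatible : List Rule → Set
    Compatible R = LAll.All (λ ρ → Rule.lhs ρ >epo Rule.rhs ρ) R

-- Compile a machine M running in time 2^(c·(n+1)^k) into a constructor TRS.  Configurations,
-- tapes and words are constructor terms, and step performs one transition of M in a constant
-- number of rewrite steps.  The exponential clock is iter(c, w, d₁, …, d_K) with K = k + c: its
-- digits are words of length ≤ |w|, read as a number r in base |w|+1, and the rules
--   iter(c, w, ε, …, ε)                → step^(2^c)(c)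
--   iter(c, w, …, S_b(x), ε, …, ε)     → iter(iter(c, w, …, x, w, …, w), w, …, x, w, …, w)
-- make it perform 2^c · 2^r steps; starting from the digits w, …, w gives r = (|w|+1)^K − 1,
-- which covers the time bound.  The nested right-hand side is oriented by the EPO because the
-- digits are normal arguments, one of which strictly decreases, while the configuration is
-- safe.  The left-hand sides are linear constructor patterns of which no two instances
-- coincide, so the system is orthogonal and hence confluent; since the input check chk gets
-- stuck on non-words, g(s) has a value as normal form exactly when s encodes a word w, and
-- that value encodes f(w).

module Submission where

open import Defs
open import Data.Bool using (Bool; true; false)
open import Data.Nat using (ℕ; zero; suc; _+_; _*_; _^_; _≤_; _<_; z≤n; s≤s; _≟_; _<?_)
open import Data.Nat.Properties
open import Data.Nat.Induction using (<-wellFounded)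
open import Data.Fin using (Fin; zero; suc; toℕ; #_; _↑ˡ_; _↑ʳ_; splitAt; combine; remQuot)
open import Data.Fin.Properties using (splitAt-↑ˡ; splitAt-↑ʳ; remQuot-combine)
open import Data.List using (List; []; _∷_; _++_; length; map; concat; allFin; cartesianProductWith)
open import Data.List.Membership.Propositional using (_∈_)
open import Data.List.Membership.Propositional.Properties
  using (∈-map⁺; ∈-map⁻; ∈-++⁺ˡ; ∈-++⁺ʳ; ∈-concat⁺′; ∈-lookup; ∈-allFin; ∈-cartesianProductWith⁺)
open import Data.List.Relation.Unary.All as LAll using ([]; _∷_)
import Data.List.Relation.Unary.All.Properties as LAllP
open import Data.List.Relation.Unary.Any using (here; there)
import Data.List.Relation.Binary.Pointwise as ListPW
open ListPW using ([]; _∷_)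
open import Data.Vec using (Vec; []; _∷_; lookup; _[_]≔_; replicate; toList)
import Data.Vec as Vec
import Data.List as List
import Data.Vec.Properties as VP
import Data.Vec.Relation.Binary.Pointwise.Inductive as VecPW
open VecPW using ([]; _∷_)
open import Data.Vec.Relation.Unary.All as VAll using ([]; _∷_)
open import Data.Vec.Relation.Unary.Any as VAny using (here; there)
open import Data.Maybe using (Maybe; just; nothing)
open import Data.Maybe.Properties using (just-injective)
open import Data.Product using (Σ; _×_; _,_; proj₁; proj₂)
open import Data.Sum using (_⊎_; inj₁; inj₂)
open import Data.Empty using (⊥; ⊥-elim)
open import Data.Unit using (⊤; tt)
open import Relation.Nullary using (¬_; Dec; yes; no)
open import Relation.Nullary.Decidable using (True; toWitness)
open import Relation.Binary.PropositionalEquality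
  using (_≡_; refl; sym; trans; cong₂; subst; module ≡-Reasoning) renaming (cong to ≡cong)
open import Relation.Binary.Construct.Closure.ReflexiveTransitive using (Star; ε; _◅_; _◅◅_; gmap)
open import Induction.WellFounded using (module Subrelation)
import Relation.Binary.Construct.On as On
open import Function using (id)

module Terms (Sg : Signature) where
  open Signature Sg

  Tm : Set
  Tm = Term Sg

  pattern V x = Term.var x
  pattern A f ts = Term.app f ts

  infixl 9 _⟪_⟫
  _⟪_⟫ : Tm → Subst Sg → Tm
  t ⟪ σ ⟫ = _⟨_⟩ Sg t σ

  substs′ : ∀ {n} → Vec Tm n → Subst Sg → Vec Tm n
  substs′ = substs Sg

  infix 4 _occ_
  _occ_ : ℕ → Tm → Set
  x occ t = _occursIn_ Sg x t

  OccursAny : ∀ {n} → ℕ → Vec Tm n → Set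
  OccursAny x ts = VAny.Any (x occ_) ts

  mutual
    size : Tm → ℕ
    size (V x) = 0
    size (A f ts) = suc (sizes ts)

    sizes : ∀ {n} → Vec Tm n → ℕ
    sizes [] = 0
    sizes (t ∷ ts) = size t + sizes ts

  mutual
    occurs⇒size≤ : ∀ {x} t (σ : Subst Sg) → x occ t → size (σ x) ≤ size (t ⟪ σ ⟫)
    occurs⇒size≤ (V x) σ here = ≤-refl
    occurs⇒size≤ (A f ts) σ (there p) = m≤n⇒m≤1+n (occursAny⇒size≤ ts σ p)

    occursAny⇒size≤ : ∀ {n x} (ts : Vec Tm n) (σ : Subst Sg) → OccursAny x ts → size (σ x) ≤ sizes (substs′ ts σ)
    occursAny⇒size≤ (t ∷ ts) σ (here p) = ≤-trans (occurs⇒size≤ t σ p) (m≤m+n _ _)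
    occursAny⇒size≤ (t ∷ ts) σ (there p) = ≤-trans (occursAny⇒size≤ ts σ p) (m≤n+m _ _)

  mutual
    occ? : ∀ x t → Dec (x occ t)
    occ? x (V y) with x ≟ y
    ... | yes refl = yes here
    ... | no ne = no λ { here → ne refl }
    occ? x (A f ts) with occAny? x ts
    ... | yes p = yes (there p)
    ... | no np = no λ { (there p) → np p }

    occAny? : ∀ {n} x (ts : Vec Tm n) → Dec (OccursAny x ts)
    occAny? x [] = no λ ()
    occAny? x (t ∷ ts) with occ? x t | occAny? x ts
    ... | yes p | _ = yes (here p)
    ... | no _ | yes q = yes (there q)
    ... | no np | no nq = no λ { (here p) → np p ; (there q) → nq q }

  mutual
    ⟪⟫-ext : ∀ t {σ τ : Subst Sg} → (∀ x → x occ t → σ x ≡ τ x) → t ⟪ σ ⟫ ≡ t ⟪ τ ⟫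
    ⟪⟫-ext (V x) h = h x here
    ⟪⟫-ext (A f ts) h = ≡cong (A f) (substs′-ext ts λ x p → h x (there p))

    substs′-ext : ∀ {n} (ts : Vec Tm n) {σ τ : Subst Sg} → (∀ x → OccursAny x ts → σ x ≡ τ x) → substs′ ts σ ≡ substs′ ts τ
    substs′-ext [] h = refl
    substs′-ext (t ∷ ts) h = cong₂ _∷_ (⟪⟫-ext t λ x p → h x (here p)) (substs′-ext ts λ x p → h x (there p))

  app-inj : ∀ {f} {ts us : Vec Tm (arity Sg f)} → A f ts ≡ A f us → ts ≡ us
  app-inj refl = refl

  mutual
    ⟪⟫-agree : ∀ t {σ τ : Subst Sg} → t ⟪ σ ⟫ ≡ t ⟪ τ ⟫ → ∀ x → x occ t → σ x ≡ τ x
    ⟪⟫-agree (V x) eq .x here = eq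
    ⟪⟫-agree (A f ts) eq x (there p) = substs′-agree ts (app-inj eq) x p

    substs′-agree : ∀ {n} (ts : Vec Tm n) {σ τ : Subst Sg} → substs′ ts σ ≡ substs′ ts τ → ∀ x → OccursAny x ts → σ x ≡ τ x
    substs′-agree (t ∷ ts) eq x (here p) = ⟪⟫-agree t (VP.∷-injectiveˡ eq) x p
    substs′-agree (t ∷ ts) eq x (there p) = substs′-agree ts (VP.∷-injectiveʳ eq) x p

  mutual
    Linear : Tm → Set
    Linear (V x) = ⊤
    Linear (A f ts) = LinearArgs ts

    LinearArgs : ∀ {n} → Vec Tm n → Set
    LinearArgs [] = ⊤
    LinearArgs (t ∷ ts) = Linear t × LinearArgs ts × (∀ x → x occ t → ¬ OccursAny x ts)

  mutual
    vars : Tm → List ℕ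
    vars (V x) = x ∷ []
    vars (A f ts) = varsArgs ts

    varsArgs : ∀ {n} → Vec Tm n → List ℕ
    varsArgs [] = []
    varsArgs (t ∷ ts) = vars t ++ varsArgs ts

  mutual
    occ⇒∈vars : ∀ {x} t → x occ t → x ∈ vars t
    occ⇒∈vars (V x) here = here refl
    occ⇒∈vars (A f ts) (there o) = occAny⇒∈varsArgs ts o

    occAny⇒∈varsArgs : ∀ {n x} (ts : Vec Tm n) → OccursAny x ts → x ∈ varsArgs ts
    occAny⇒∈varsArgs (t ∷ ts) (here o) = ∈-++⁺ˡ (occ⇒∈vars t o)
    occAny⇒∈varsArgs (t ∷ ts) (there o) = ∈-++⁺ʳ (vars t) (occAny⇒∈varsArgs ts o)

  vars⊆lhs : ∀ (l r : Tm) → LAll.All (λ x → x occ l) (vars r) → ∀ x → x occ r → x occ l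
  vars⊆lhs l r al x o = LAll.lookup al (occ⇒∈vars r o)

  headDefined : Tm → Bool
  headDefined (V x) = false
  headDefined (A f ts) = isDefined Sg f

  rankPrecedence : (FSym Sg → ℕ) → QuasiPrecedence Sg
  rankPrecedence rank = record
    { _≿_ = λ f g → rank g ≤ rank f
    ; ≿-refl = ≤-refl
    ; ≿-trans = λ p q → ≤-trans q p
    ; ≻-wf = Subrelation.wellFounded (λ { (p , np) → ≰⇒> np }) (On.wellFounded rank <-wellFounded)
    }

  module Rewriting (R : List (Rule Sg)) where
    _⟶'_ : Tm → Tm → Set
    _⟶'_ = _⟶_ Sg R
    _⟶ᵢ'_ : Tm → Tm → Set
    _⟶ᵢ'_ = _⟶ᵢ_ Sg R
    NF' : Tm → Set
    NF' = NF Sg R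

    ⟶*-app : ∀ f {ts us : Vec Tm (arity Sg f)} → VecPW.Pointwise (Star _⟶'_) ts us → Star _⟶'_ (A f ts) (A f us)
    ⟶*-app f = args (A f) (λ i → _⟶_.cong i)
      where
      args : ∀ {n} (ctx : Vec Tm n → Tm) →
        (∀ {ts} (i : Fin n) {u} → lookup ts i ⟶' u → ctx ts ⟶' ctx (ts [ i ]≔ u)) →
        ∀ {ts us} → VecPW.Pointwise (Star _⟶'_) ts us → Star _⟶'_ (ctx ts) (ctx us)
      args ctx step [] = ε
      args ctx step {t ∷ ts} {u ∷ us} (p ∷ ps) =
        gmap (λ v → ctx (v ∷ ts)) (step zero) p ◅◅ args (λ vs → ctx (u ∷ vs)) (λ i → step (suc i)) ps

    mutual
      ⟶*-⟪⟫ : ∀ t {σ τ : Subst Sg} → (∀ x → Star _⟶'_ (σ x) (τ x)) → Star _⟶'_ (t ⟪ σ ⟫) (t ⟪ τ ⟫)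
      ⟶*-⟪⟫ (V x) h = h x
      ⟶*-⟪⟫ (A f ts) h = ⟶*-app f (⟶*-substs′ ts h)

      ⟶*-substs′ : ∀ {n} (ts : Vec Tm n) {σ τ : Subst Sg} → (∀ x → Star _⟶'_ (σ x) (τ x)) → VecPW.Pointwise (Star _⟶'_) (substs′ ts σ) (substs′ ts τ)
      ⟶*-substs′ [] h = []
      ⟶*-substs′ (t ∷ ts) h = ⟶*-⟪⟫ t h ∷ ⟶*-substs′ ts h

    _⟶ᵢ*'_ : Tm → Tm → Set
    _⟶ᵢ*'_ = Star _⟶ᵢ'_

    ⟶ᵢ*-arg′ : ∀ {f} (i : Fin (arity Sg f)) {ts : Vec Tm (arity Sg f)} {t u} → lookup ts i ≡ t → t ⟶ᵢ*' u →
            A f ts ⟶ᵢ*' A f (ts Vec.[ i ]≔ u)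
    ⟶ᵢ*-arg′ {f} i {ts} refl ε = subst (λ z → A f ts ⟶ᵢ*' A f z) (sym (VP.[]≔-lookup ts i)) ε
    ⟶ᵢ*-arg′ {f} i {ts} refl (_◅_ {j = u₁} x xs) =
      _⟶ᵢ_.cong i x ◅ subst (λ z → A f (ts Vec.[ i ]≔ u₁) ⟶ᵢ*' A f z) (VP.[]≔-idempotent ts i)
        (⟶ᵢ*-arg′ i (VP.lookup∘update i ts u₁) xs)

    ⟶ᵢ*-arg : ∀ {f} (i : Fin (arity Sg f)) {ts : Vec Tm (arity Sg f)} {u} → lookup ts i ⟶ᵢ*' u → A f ts ⟶ᵢ*' A f (ts Vec.[ i ]≔ u)
    ⟶ᵢ*-arg i p = ⟶ᵢ*-arg′ i refl p

    ⟶ᵢ⇒⟶ : ∀ {s t} → s ⟶ᵢ' t → s ⟶' t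
    ⟶ᵢ⇒⟶ (_⟶ᵢ_.root m σ _) = _⟶_.root m σ
    ⟶ᵢ⇒⟶ (_⟶ᵢ_.cong i p) = _⟶_.cong i (⟶ᵢ⇒⟶ p)

    ⟶ᵢ*⇒⟶* : ∀ {s t} → s ⟶ᵢ*' t → Star _⟶'_ s t
    ⟶ᵢ*⇒⟶* = gmap id ⟶ᵢ⇒⟶

    NF-⟶*-≡ : ∀ {s t} → NF' s → Star _⟶'_ s t → s ≡ t
    NF-⟶*-≡ n ε = refl
    NF-⟶*-≡ n (x ◅ xs) = ⊥-elim (n _ x)

  -- Tait–Martin-Löf: parallel reduction ⇉ has the diamond property (by induction on the size
  -- of the source) and its reflexive–transitive closure is that of ⟶.
  module Orthogonal (R : List (Rule Sg))
    (heads-defined : ∀ {ρ} → ρ ∈ R → isDefined Sg (Rule.fn ρ) ≡ true)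
    (patterns-values : ∀ {ρ} → ρ ∈ R → VAll.All (IsValue Sg) (Rule.pats ρ))
    (patterns-linear : ∀ {ρ} → ρ ∈ R → LinearArgs (Rule.pats ρ))
    (variable-condition : ∀ {ρ} → ρ ∈ R → IsRule Sg ρ)
    (non-overlap : ∀ {ρ₁ ρ₂ σ₁ σ₂} → ρ₁ ∈ R → ρ₂ ∈ R → Rule.lhs ρ₁ ⟪ σ₁ ⟫ ≡ Rule.lhs ρ₂ ⟪ σ₂ ⟫ → ρ₁ ≡ ρ₂)
    where

    open Rewriting R

    infix 4 _⇉_ _⇉ₐ_

    mutual
      data _⇉_ : Tm → Tm → Set where
        pvar : ∀ {x} → V x ⇉ V x
        papp : ∀ {f ts us} → ts ⇉ₐ us → A f ts ⇉ A f us
        pred : ∀ {ρ σ τ s t} → ρ ∈ R → (∀ x → σ x ⇉ τ x) →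
               s ≡ Rule.lhs ρ ⟪ σ ⟫ → t ≡ Rule.rhs ρ ⟪ τ ⟫ → s ⇉ t

      data _⇉ₐ_ : ∀ {n} → Vec Tm n → Vec Tm n → Set where
        [] : [] ⇉ₐ []
        _∷_ : ∀ {n t u} {ts us : Vec Tm n} → t ⇉ u → ts ⇉ₐ us → (t ∷ ts) ⇉ₐ (u ∷ us)

    mutual
      ⇉-refl : ∀ t → t ⇉ t
      ⇉-refl (V x) = pvar
      ⇉-refl (A f ts) = papp (⇉ₐ-refl ts)

      ⇉ₐ-refl : ∀ {n} (ts : Vec Tm n) → ts ⇉ₐ ts
      ⇉ₐ-refl [] = []
      ⇉ₐ-refl (t ∷ ts) = ⇉-refl t ∷ ⇉ₐ-refl ts

    mutual
      ⇉-⟪⟫ : ∀ t {σ τ : Subst Sg} → (∀ x → x occ t → σ x ⇉ τ x) → (t ⟪ σ ⟫) ⇉ (t ⟪ τ ⟫)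
      ⇉-⟪⟫ (V x) h = h x here
      ⇉-⟪⟫ (A f ts) h = papp (⇉ₐ-substs′ ts λ x p → h x (there p))

      ⇉ₐ-substs′ : ∀ {n} (ts : Vec Tm n) {σ τ : Subst Sg} → (∀ x → OccursAny x ts → σ x ⇉ τ x) → substs′ ts σ ⇉ₐ substs′ ts τ
      ⇉ₐ-substs′ [] h = []
      ⇉ₐ-substs′ (t ∷ ts) h = ⇉-⟪⟫ t (λ x p → h x (here p)) ∷ ⇉ₐ-substs′ ts (λ x p → h x (there p))

    update : Subst Sg → ℕ → Tm → Subst Sg
    update σ x u y with y ≟ x
    ... | yes _ = u
    ... | no _ = σ y

    update-same : ∀ σ x u → update σ x u x ≡ u
    update-same σ x u with x ≟ x
    ... | yes _ = refl
    ... | no ne = ⊥-elim (ne refl)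

    update-other : ∀ σ x u y → ¬ y ≡ x → update σ x u y ≡ σ y
    update-other σ x u y ne with y ≟ x
    ... | yes e = ⊥-elim (ne e)
    ... | no _ = refl

    merge : Tm → Subst Sg → Subst Sg → Subst Sg
    merge p θ₁ θ₂ y with occ? y p
    ... | yes _ = θ₁ y
    ... | no _ = θ₂ y

    merge-left : ∀ p θ₁ θ₂ y → y occ p → merge p θ₁ θ₂ y ≡ θ₁ y
    merge-left p θ₁ θ₂ y o with occ? y p
    ... | yes _ = refl
    ... | no no' = ⊥-elim (no' o)

    merge-right : ∀ p θ₁ θ₂ y → ¬ y occ p → merge p θ₁ θ₂ y ≡ θ₂ y
    merge-right p θ₁ θ₂ y o with occ? y p
    ... | yes yo = ⊥-elim (o yo)
    ... | no _ = refl

    ParInstance : Tm → Subst Sg → Tm → Set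
    ParInstance p σ u = Σ (Subst Sg) λ θ → (u ≡ p ⟪ θ ⟫) × (∀ x → σ x ⇉ θ x) × (∀ x → ¬ x occ p → θ x ≡ σ x)

    ParInstances : ∀ {n} → Vec Tm n → Subst Sg → Vec Tm n → Set
    ParInstances ps σ us = Σ (Subst Sg) λ θ → (us ≡ substs′ ps θ) × (∀ x → σ x ⇉ θ x) × (∀ x → ¬ OccursAny x ps → θ x ≡ σ x)

    constructor-not-redex : ∀ {c} {ts : Vec Tm (arity Sg c)} {ρ} {σ : Subst Sg} → isDefined Sg c ≡ false → ρ ∈ R →
              A c ts ≡ Rule.lhs ρ ⟪ σ ⟫ → ⊥
    constructor-not-redex {ρ = ρ} cf m eq with trans (sym cf) (trans (≡cong headDefined eq) (heads-defined m))
    ... | ()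

    mutual
      ⇉-instance : ∀ p {σ u} → IsValue Sg p → Linear p → (p ⟪ σ ⟫) ⇉ u → ParInstance p σ u
      ⇉-instance (V x) {σ} {u} _ _ d =
        update σ x u , sym (update-same σ x u) , dd , λ y ny → update-other σ x u y (λ e → ny (subst (λ z → y occ V z) e here))
        where
        dd : ∀ y → σ y ⇉ update σ x u y
        dd y with y ≟ x
        ... | yes refl = d
        ... | no _ = ⇉-refl (σ y)
      ⇉-instance (A c ps) (IsValue.app cf vs) l (papp pw) with ⇉ₐ-instances ps vs l pw
      ... | θ , e , dθ , oθ = θ , ≡cong (A c) e , dθ , λ y ny → oθ y (λ o → ny (there o))
      ⇉-instance (A c ps) (IsValue.app cf vs) l (pred m _ eq _) = ⊥-elim (constructor-not-redex cf m eq)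

      ⇉ₐ-instances : ∀ {n} (ps : Vec Tm n) {σ us} → VAll.All (IsValue Sg) ps → LinearArgs ps → substs′ ps σ ⇉ₐ us → ParInstances ps σ us
      ⇉ₐ-instances [] {σ} [] _ [] = σ , refl , (λ x → ⇉-refl (σ x)) , λ _ _ → refl
      ⇉ₐ-instances (p ∷ ps) {σ} (v ∷ vs) (lp , lps , disj) (d ∷ pw) with ⇉-instance p v lp d | ⇉ₐ-instances ps vs lps pw
      ... | θ₁ , e₁ , d₁ , o₁ | θ₂ , e₂ , d₂ , o₂ =
        θ , cong₂ _∷_ (trans e₁ (⟪⟫-ext p λ y o → sym (merge-left p θ₁ θ₂ y o)))
                      (trans e₂ (substs′-ext ps λ y o → sym (merge-right p θ₁ θ₂ y λ op → disj y op o))) ,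
        dd , oo
        where
        θ = merge p θ₁ θ₂
        dd : ∀ y → σ y ⇉ θ y
        dd y with occ? y p
        ... | yes _ = d₁ y
        ... | no _ = d₂ y
        oo : ∀ y → ¬ OccursAny y (p ∷ ps) → θ y ≡ σ y
        oo y ny with occ? y p
        ... | yes op = ⊥-elim (ny (here op))
        ... | no _ = o₂ y (λ o → ny (there o))

    Join : Tm → Tm → Set
    Join a b = Σ Tm λ v → a ⇉ v × b ⇉ v

    SubstJoin : ∀ {n} → Vec Tm n → Subst Sg → Subst Sg → Set
    SubstJoin ps τ₁ τ₂ = Σ (Subst Sg) λ υ → (∀ x → OccursAny x ps → τ₁ x ⇉ υ x) × (∀ x → OccursAny x ps → τ₂ x ⇉ υ x) ×
                         (∀ x → ¬ OccursAny x ps → υ x ≡ τ₁ x)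

    occursAny⇒size< : ∀ {n k x} (ps : Vec Tm k) (σ : Subst Sg) → sizes (substs′ ps σ) < n → OccursAny x ps → size (σ x) < n
    occursAny⇒size< ps σ lt o = ≤-trans (s≤s (occursAny⇒size≤ ps σ o)) lt

    rhs→lhs : ∀ {ρ} → ρ ∈ R → ∀ x → x occ Rule.rhs ρ → OccursAny x (Rule.pats ρ)
    rhs→lhs m x o with variable-condition m x o
    ... | there o' = o'

    mutual
      diamond< : ∀ n {s t₁ t₂} → size s < n → s ⇉ t₁ → s ⇉ t₂ → Join t₁ t₂
      diamond< (suc n) lt pvar pvar = V _ , pvar , pvar
      diamond< (suc n) lt pvar (pred m d () _)
      diamond< (suc n) lt (pred m d () _) pvar
      diamond< (suc n) (s≤s lt) (papp p₁) (papp p₂) with diamondₐ< n lt p₁ p₂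
      ... | vs , q₁ , q₂ = A _ vs , papp q₁ , papp q₂
      diamond< (suc n) (s≤s lt) (papp p₁) (pred {ρ} m d refl refl) = join-redex-args n m lt d p₁
      diamond< (suc n) (s≤s lt) (pred {ρ} m d refl refl) (papp p₂) with join-redex-args n m lt d p₂
      ... | v , a , b = v , b , a
      diamond< (suc n) (s≤s lt) (pred {ρ₁} {σ₁} {τ₁} m₁ d₁ refl refl) (pred {ρ₂} {σ₂} {τ₂} m₂ d₂ eq refl)
        with non-overlap m₁ m₂ eq
      ... | refl with join-substs n ρ₁ m₁ {σ₁} {τ₁} {τ₂} lt (λ x _ → d₁ x)
                        (λ x o → subst (λ z → z ⇉ τ₂ x) (sym (substs′-agree (Rule.pats ρ₁) (app-inj eq) x o)) (d₂ x))
      ... | υ , j₁ , j₂ , _ =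
        Rule.rhs ρ₁ ⟪ υ ⟫ , ⇉-⟪⟫ (Rule.rhs ρ₁) (λ x o → j₁ x (rhs→lhs m₁ x o)) ,
                            ⇉-⟪⟫ (Rule.rhs ρ₁) (λ x o → j₂ x (rhs→lhs m₁ x o))

      diamondₐ< : ∀ n {k} {ts us₁ us₂ : Vec Tm k} → sizes ts < n → ts ⇉ₐ us₁ → ts ⇉ₐ us₂ →
             Σ (Vec Tm k) λ vs → us₁ ⇉ₐ vs × us₂ ⇉ₐ vs
      diamondₐ< n lt [] [] = [] , [] , []
      diamondₐ< n {ts = t ∷ ts} lt (d₁ ∷ p₁) (d₂ ∷ p₂) with diamond< n (≤-trans (s≤s (m≤m+n (size t) (sizes ts))) lt) d₁ d₂
                                                      | diamondₐ< n (≤-trans (s≤s (m≤n+m (sizes ts) (size t))) lt) p₁ p₂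
      ... | v , a , b | vs , as , bs = v ∷ vs , a ∷ as , b ∷ bs

      join-substs : ∀ n ρ → ρ ∈ R → ∀ {σ τ₁ τ₂ : Subst Sg} → sizes (substs′ (Rule.pats ρ) σ) < n →
                (∀ x → OccursAny x (Rule.pats ρ) → σ x ⇉ τ₁ x) → (∀ x → OccursAny x (Rule.pats ρ) → σ x ⇉ τ₂ x) →
                SubstJoin (Rule.pats ρ) τ₁ τ₂
      join-substs n ρ m {σ} {τ₁} {τ₂} lt d₁ d₂ = υ , j₁ , j₂ , j₃
        where
        ps : Vec Tm (arity Sg (Rule.fn ρ))
        ps = Rule.pats ρ
        υ : Subst Sg
        υ x with occAny? x ps
        ... | yes o = proj₁ (diamond< n (occursAny⇒size< ps σ lt o) (d₁ x o) (d₂ x o))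
        ... | no _ = τ₁ x
        j₁ : ∀ x → OccursAny x ps → τ₁ x ⇉ υ x
        j₁ x o with occAny? x ps
        ... | yes o' = proj₁ (proj₂ (diamond< n (occursAny⇒size< ps σ lt o') (d₁ x o') (d₂ x o')))
        ... | no no' = ⊥-elim (no' o)
        j₂ : ∀ x → OccursAny x ps → τ₂ x ⇉ υ x
        j₂ x o with occAny? x ps
        ... | yes o' = proj₂ (proj₂ (diamond< n (occursAny⇒size< ps σ lt o') (d₁ x o') (d₂ x o')))
        ... | no no' = ⊥-elim (no' o)
        j₃ : ∀ x → ¬ OccursAny x ps → υ x ≡ τ₁ x
        j₃ x no' with occAny? x ps
        ... | yes o = ⊥-elim (no' o)
        ... | no _ = refl

      join-redex-args : ∀ n {ρ σ τ us} → ρ ∈ R → sizes (substs′ (Rule.pats ρ) σ) < n → (∀ x → σ x ⇉ τ x) →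
               substs′ (Rule.pats ρ) σ ⇉ₐ us → Join (A (Rule.fn ρ) us) (Rule.rhs ρ ⟪ τ ⟫)
      join-redex-args n {ρ} {σ} {τ} {us} m lt d pw with ⇉ₐ-instances (Rule.pats ρ) (patterns-values m) (patterns-linear m) pw
      ... | θ , e , dθ , oθ with join-substs n ρ m {σ} {θ} {τ} lt (λ x _ → dθ x) (λ x _ → d x)
      ... | υ , j₁ , j₂ , j₃ =
        Rule.rhs ρ ⟪ υ ⟫ ,
        pred m θυ (≡cong (A (Rule.fn ρ)) e) refl ,
        ⇉-⟪⟫ (Rule.rhs ρ) (λ x o → j₂ x (rhs→lhs m x o))
        where
        θυ : ∀ x → θ x ⇉ υ x
        θυ x with occAny? x (Rule.pats ρ)
        ... | yes o = j₁ x o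
        ... | no no' = subst (λ z → θ x ⇉ z) (sym (j₃ x no')) (⇉-refl (θ x))

    ⇉ₐ-update : ∀ {n} (ts : Vec Tm n) (i : Fin n) {u} → lookup ts i ⇉ u → ts ⇉ₐ (ts [ i ]≔ u)
    ⇉ₐ-update (t ∷ ts) zero d = d ∷ ⇉ₐ-refl ts
    ⇉ₐ-update (t ∷ ts) (suc i) d = ⇉-refl t ∷ ⇉ₐ-update ts i d

    ⟶⇒⇉ : ∀ {s t} → s ⟶' t → s ⇉ t
    ⟶⇒⇉ (_⟶_.root m σ) = pred m (λ x → ⇉-refl (σ x)) refl refl
    ⟶⇒⇉ (_⟶_.cong {ts = ts} i p) = papp (⇉ₐ-update ts i (⟶⇒⇉ p))

    mutual
      ⇉⇒⟶* : ∀ {s t} → s ⇉ t → Star _⟶'_ s t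
      ⇉⇒⟶* pvar = ε
      ⇉⇒⟶* (papp {f = f} pw) = ⟶*-app f (⇉ₐ⇒⟶* pw)
      ⇉⇒⟶* (pred {ρ} {σ} {τ} m d refl refl) = ⟶*-⟪⟫ (Rule.lhs ρ) (λ x → ⇉⇒⟶* (d x)) ◅◅ (_⟶_.root m τ ◅ ε)

      ⇉ₐ⇒⟶* : ∀ {n} {ts us : Vec Tm n} → ts ⇉ₐ us → VecPW.Pointwise (Star _⟶'_) ts us
      ⇉ₐ⇒⟶* [] = []
      ⇉ₐ⇒⟶* (d ∷ pw) = ⇉⇒⟶* d ∷ ⇉ₐ⇒⟶* pw

    diamond : ∀ {s t₁ t₂} → s ⇉ t₁ → s ⇉ t₂ → Join t₁ t₂
    diamond {s} = diamond< (suc (size s)) (s≤s ≤-refl)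

    strip : ∀ {s t u} → s ⇉ t → Star _⇉_ s u → Σ Tm λ v → Star _⇉_ t v × u ⇉ v
    strip d ε = _ , ε , d
    strip d (x ◅ xs) with diamond d x
    ... | v , a , b with strip b xs
    ... | w , c , e = w , a ◅ c , e

    ⇉*-confluent : ∀ {s t u} → Star _⇉_ s t → Star _⇉_ s u → Σ Tm λ v → Star _⇉_ t v × Star _⇉_ u v
    ⇉*-confluent ε q = _ , q , ε
    ⇉*-confluent (x ◅ xs) q with strip x q
    ... | v , a , b with ⇉*-confluent xs a
    ... | w , c , e = w , c , b ◅ e

    ⟶*⇒⇉* : ∀ {s t} → Star _⟶'_ s t → Star _⇉_ s t
    ⟶*⇒⇉* = gmap id ⟶⇒⇉

    ⇉*⇒⟶* : ∀ {s t} → Star _⇉_ s t → Star _⟶'_ s t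
    ⇉*⇒⟶* ε = ε
    ⇉*⇒⟶* (x ◅ xs) = ⇉⇒⟶* x ◅◅ ⇉*⇒⟶* xs

    confluent : Confluent Sg R
    confluent p q with ⇉*-confluent (⟶*⇒⇉* p) (⟶*⇒⇉* q)
    ... | v , a , b = v , ⇉*⇒⟶* a , ⇉*⇒⟶* b


pow-grows : ∀ N c → suc c ≤ suc (suc N) ^ c
pow-grows N zero = s≤s z≤n
pow-grows N (suc c) = begin
    suc (suc c)      ≡⟨ +-comm 1 (suc c) ⟩
    suc c + 1        ≤⟨ +-mono-≤ ih (≤-trans (≤-trans (s≤s z≤n) ih) (m≤m+n x (N * x))) ⟩
    x + (x + N * x)  ∎
  where
  open ≤-Reasoning
  x : ℕ
  x = suc (suc N) ^ c
  ih : suc c ≤ x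
  ih = pow-grows N c

-- With r + 1 = (N+1)^(k+c), a time bound 2^(c·(N+1)^k) is at most 2^c · 2^r.
exponent-bound : ∀ c k N r → suc r ≡ suc N ^ (k + c) → c * suc N ^ k ≤ c + r
exponent-bound c k zero r e = ≤-trans (≤-reflexive (trans (≡cong (c *_) (^-zeroˡ k)) (*-identityʳ c))) (m≤m+n c r)
exponent-bound c k (suc N) r e = +-cancelˡ-≤ 1 _ _ (begin
    suc (c * p)               ≤⟨ +-monoˡ-≤ (c * p) (m^n>0 (suc (suc N)) k) ⟩
    p + c * p                 ≡⟨ ≡cong (p +_) (*-comm c p) ⟩
    p + p * c                 ≡⟨ sym (*-suc p c) ⟩
    p * suc c                 ≤⟨ *-monoʳ-≤ p (pow-grows N c) ⟩
    p * suc (suc N) ^ c       ≡⟨ sym (^-distribˡ-+-* (suc (suc N)) k c) ⟩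
    suc (suc N) ^ (k + c)     ≡⟨ sym e ⟩
    suc r                     ≤⟨ m≤n+m (suc r) c ⟩
    c + suc r                 ≡⟨ +-suc c r ⟩
    suc (c + r)               ∎)
  where
  open ≤-Reasoning
  p : ℕ
  p = suc (suc N) ^ k


module MachineTRS (M : TM) (cc kk : ℕ) where
  open TM M

  NS : ℕ
  NS = suc nstates
  NA : ℕ
  NA = 3 + nextra
  St : Set
  St = Fin NS
  Sy : Set
  Sy = Fin NA
  digits : ℕ
  digits = kk + cc
  blockSteps : ℕ
  blockSteps = 2 ^ cc

  -- Constructors: K q a (l, r) is the configuration in state q scanning a with tapes l and r;
  -- C a (w, r) is a tape cell a followed by r, caching the word w read from a rightwards.
  -- The defined symbols i0, …, i8 are g, g′, chk, conv, mk, out, wof, iter, step; the family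
  -- i9 consists of mvL q, mvR q and psh a.
  pattern i0 = zero
  pattern i1 = suc i0
  pattern i2 = suc i1
  pattern i3 = suc i2
  pattern i4 = suc i3
  pattern i5 = suc i4
  pattern i6 = suc i5
  pattern i7 = suc i6
  pattern i8 = suc i7
  pattern i9 x = suc (suc (suc (suc (suc (suc (suc (suc (suc x))))))))

  defArity : Fin (9 + (NS + (NS + NA))) → ℕ
  defArity i0 = 1
  defArity i1 = 2
  defArity i2 = 1
  defArity i3 = 1
  defArity i4 = 1
  defArity i5 = 1
  defArity i6 = 1
  defArity i7 = suc (suc digits)
  defArity i8 = 1
  defArity (i9 _) = 2

  sig : Signature
  sig = record { ncon = NS * NA + NA ; conAr = λ _ → 2 ; ndef = 9 + (NS + (NS + NA)) ; defAr = defArity }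

  open Terms sig public

  FS : Set
  FS = FSym sig

  gS g′S chkS convS mkS outS wofS iterS stepS : FS
  gS = def i0
  g′S = def i1
  chkS = def i2
  convS = def i3
  mkS = def i4
  outS = def i5
  wofS = def i6
  iterS = def i7
  stepS = def i8
  mvLS mvRS : St → FS
  mvLS q = def (i9 (q ↑ˡ (NS + NA)))
  mvRS q = def (i9 (NS ↑ʳ (q ↑ˡ NA)))
  pshS : Sy → FS
  pshS a = def (i9 (NS ↑ʳ (NS ↑ʳ a)))
  KS : St → Sy → FS
  KS q a = con (combine q a ↑ˡ NA)
  CS : Sy → FS
  CS a = con ((NS * NA) ↑ʳ a)

  eps : Tm
  eps = A ε []
  s0 s1 : Tm → Tm
  s0 t = A S₀ (t ∷ [])
  s1 t = A S₁ (t ∷ [])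
  sB : Bool → Tm → Tm
  sB false = s0
  sB true = s1
  Kt : St → Sy → Tm → Tm → Tm
  Kt q a l r = A (KS q a) (l ∷ r ∷ [])
  Ct : Sy → Tm → Tm → Tm
  Ct a w r = A (CS a) (w ∷ r ∷ [])
  chkT convT mkT outT wofT stepT : Tm → Tm
  chkT t = A chkS (t ∷ [])
  convT t = A convS (t ∷ [])
  mkT t = A mkS (t ∷ [])
  outT t = A outS (t ∷ [])
  wofT t = A wofS (t ∷ [])
  stepT t = A stepS (t ∷ [])

  bw : Sy → Tm → Tm
  bw zero t = eps
  bw (suc zero) t = s0 t
  bw (suc (suc zero)) t = s1 t
  bw (suc (suc (suc _))) t = eps

  stepTⁿ : ℕ → Tm → Tm
  stepTⁿ zero t = t
  stepTⁿ (suc n) t = A stepS (stepTⁿ n t ∷ [])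

  blankS : Sy
  blankS = zero

  digitPats : ∀ {n} → (ℕ → ℕ) → Fin n → Bool → Vec Tm n
  digitPats {suc n} v zero b = sB b (V (v 0)) ∷ replicate n eps
  digitPats {suc n} v (suc j) b = V (v 0) ∷ digitPats (λ m → v (suc m)) j b

  digitsDecremented : ∀ {n} → (ℕ → ℕ) → Fin n → Vec Tm n
  digitsDecremented {suc n} v zero = V (v 0) ∷ replicate n (V 1)
  digitsDecremented {suc n} v (suc j) = V (v 0) ∷ digitsDecremented (λ m → v (suc m)) j

  digitVar : ℕ → ℕ
  digitVar m = suc (suc m)

  iterT : Tm → Tm → Vec Tm digits → Tm
  iterT c x0 ds = A iterS (c ∷ x0 ∷ ds)

  data Key : Set where
    kg kg′ kchkε kconvε kmkε kwofε kiterε : Key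
    kchk kconv : Bool → Key
    kmk kwof : Sy → Key
    kout kstep : St → Sy → Key
    kiter : Fin digits → Bool → Key
    kmvLε kmvRε : St → Key
    kmvL kmvR : St → Sy → Key
    kpshε : Sy → Key
    kpsh : Sy → Sy → Key

  stepRhs : St → Sy → Maybe (St × Sy × Move) → Tm
  stepRhs q a nothing = Kt q a (V 0) (V 1)
  stepRhs q a (just (q' , b , stay)) = Kt q' b (V 0) (V 1)
  stepRhs q a (just (q' , b , left)) = A (mvLS q') (V 0 ∷ A (pshS b) (V 1 ∷ eps ∷ []) ∷ [])
  stepRhs q a (just (q' , b , right)) = A (mvRS q') (V 1 ∷ A (pshS b) (V 0 ∷ eps ∷ []) ∷ [])

  ruleOf : Key → Rule sig
  ruleOf kg = rule gS (V 0 ∷ []) (A g′S (V 0 ∷ chkT (V 0) ∷ []))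
  ruleOf kg′ = rule g′S (V 0 ∷ eps ∷ []) (outT (iterT (mkT (convT (V 0))) (V 0) (replicate digits (V 0))))
  ruleOf kchkε = rule chkS (eps ∷ []) eps
  ruleOf (kchk b) = rule chkS (sB b (V 0) ∷ []) (chkT (V 0))
  ruleOf kconvε = rule convS (eps ∷ []) eps
  ruleOf (kconv b) = rule convS (sB b (V 0) ∷ []) (A (pshS (bitSym M b)) (convT (V 0) ∷ eps ∷ []))
  ruleOf kmkε = rule mkS (eps ∷ []) (Kt start blankS eps eps)
  ruleOf (kmk a) = rule mkS (Ct a (V 0) (V 1) ∷ []) (Kt start a eps (V 1))
  ruleOf (kout q a) = rule outS (Kt q a (V 0) (V 1) ∷ []) (bw a (wofT (V 1)))
  ruleOf kwofε = rule wofS (eps ∷ []) eps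
  ruleOf (kwof a) = rule wofS (Ct a (V 0) (V 1) ∷ []) (V 0)
  ruleOf kiterε = rule iterS (V 0 ∷ V 1 ∷ replicate digits eps) (stepTⁿ blockSteps (V 0))
  ruleOf (kiter j b) = rule iterS (V 0 ∷ V 1 ∷ digitPats digitVar j b) (iterT (iterT (V 0) (V 1) (digitsDecremented digitVar j)) (V 1) (digitsDecremented digitVar j))
  ruleOf (kstep q a) = rule stepS (Kt q a (V 0) (V 1) ∷ []) (stepRhs q a (δ q a))
  ruleOf (kmvLε q) = rule (mvLS q) (eps ∷ V 0 ∷ []) (Kt q blankS eps (V 0))
  ruleOf (kmvL q a) = rule (mvLS q) (Ct a (V 0) (V 1) ∷ V 2 ∷ []) (Kt q a (V 1) (V 2))
  ruleOf (kmvRε q) = rule (mvRS q) (eps ∷ V 0 ∷ []) (Kt q blankS (V 0) eps)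
  ruleOf (kmvR q a) = rule (mvRS q) (Ct a (V 0) (V 1) ∷ V 2 ∷ []) (Kt q a (V 2) (V 1))
  ruleOf (kpshε a) = rule (pshS a) (eps ∷ V 0 ∷ []) (Ct a (bw a eps) eps)
  ruleOf (kpsh a a') = rule (pshS a) (Ct a' (V 0) (V 1) ∷ V 2 ∷ []) (Ct a (bw a (V 0)) (Ct a' (V 0) (V 1)))

  bools : List Bool
  bools = false ∷ true ∷ []

  ∈-bools : ∀ b → b ∈ bools
  ∈-bools false = here refl
  ∈-bools true = there (here refl)

  allStates : List St
  allStates = allFin NS

  allSyms : List Sy
  allSyms = allFin NA

  fixedKeys : List Key
  fixedKeys = kg ∷ kg′ ∷ kchkε ∷ kconvε ∷ kmkε ∷ kwofε ∷ kiterε ∷ []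

  keyFamilies : List (List Key)
  keyFamilies = fixedKeys
    ∷ map kchk bools ∷ map kconv bools ∷ map kmk allSyms ∷ map kwof allSyms
    ∷ cartesianProductWith kout allStates allSyms ∷ cartesianProductWith kstep allStates allSyms
    ∷ cartesianProductWith kiter (allFin digits) bools
    ∷ map kmvLε allStates ∷ map kmvRε allStates
    ∷ cartesianProductWith kmvL allStates allSyms ∷ cartesianProductWith kmvR allStates allSyms
    ∷ map kpshε allSyms ∷ cartesianProductWith kpsh allSyms allSyms ∷ []

  allKeys : List Key
  allKeys = concat keyFamilies

  inFamily : ∀ {k} i → k ∈ List.lookup keyFamilies i → k ∈ allKeys
  inFamily i p = ∈-concat⁺′ p (∈-lookup {xs = keyFamilies} i)

  ∈-allKeys : ∀ k → k ∈ allKeys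
  ∈-allKeys kg = inFamily (# 0) (∈-lookup {xs = fixedKeys} (# 0))
  ∈-allKeys kg′ = inFamily (# 0) (∈-lookup {xs = fixedKeys} (# 1))
  ∈-allKeys kchkε = inFamily (# 0) (∈-lookup {xs = fixedKeys} (# 2))
  ∈-allKeys kconvε = inFamily (# 0) (∈-lookup {xs = fixedKeys} (# 3))
  ∈-allKeys kmkε = inFamily (# 0) (∈-lookup {xs = fixedKeys} (# 4))
  ∈-allKeys kwofε = inFamily (# 0) (∈-lookup {xs = fixedKeys} (# 5))
  ∈-allKeys kiterε = inFamily (# 0) (∈-lookup {xs = fixedKeys} (# 6))
  ∈-allKeys (kchk b) = inFamily (# 1) (∈-map⁺ kchk (∈-bools b))
  ∈-allKeys (kconv b) = inFamily (# 2) (∈-map⁺ kconv (∈-bools b))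
  ∈-allKeys (kmk a) = inFamily (# 3) (∈-map⁺ kmk (∈-allFin a))
  ∈-allKeys (kwof a) = inFamily (# 4) (∈-map⁺ kwof (∈-allFin a))
  ∈-allKeys (kout q a) = inFamily (# 5) (∈-cartesianProductWith⁺ kout (∈-allFin q) (∈-allFin a))
  ∈-allKeys (kstep q a) = inFamily (# 6) (∈-cartesianProductWith⁺ kstep (∈-allFin q) (∈-allFin a))
  ∈-allKeys (kiter j b) = inFamily (# 7) (∈-cartesianProductWith⁺ kiter (∈-allFin j) (∈-bools b))
  ∈-allKeys (kmvLε q) = inFamily (# 8) (∈-map⁺ kmvLε (∈-allFin q))
  ∈-allKeys (kmvRε q) = inFamily (# 9) (∈-map⁺ kmvRε (∈-allFin q))
  ∈-allKeys (kmvL q a) = inFamily (# 10) (∈-cartesianProductWith⁺ kmvL (∈-allFin q) (∈-allFin a))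
  ∈-allKeys (kmvR q a) = inFamily (# 11) (∈-cartesianProductWith⁺ kmvR (∈-allFin q) (∈-allFin a))
  ∈-allKeys (kpshε a) = inFamily (# 12) (∈-map⁺ kpshε (∈-allFin a))
  ∈-allKeys (kpsh a a') = inFamily (# 13) (∈-cartesianProductWith⁺ kpsh (∈-allFin a) (∈-allFin a'))

  R : List (Rule sig)
  R = map ruleOf allKeys

  ruleOf∈R : ∀ k → ruleOf k ∈ R
  ruleOf∈R k = ∈-map⁺ ruleOf {xs = allKeys} (∈-allKeys k)

  ∈R⇒ruleOf : ∀ {ρ} → ρ ∈ R → Σ Key λ k → ρ ≡ ruleOf k
  ∈R⇒ruleOf m with ∈-map⁻ ruleOf {xs = allKeys} m
  ... | k , _ , e = k , e

  forAllRules : ∀ (P : Rule sig → Set) → (∀ k → P (ruleOf k)) → ∀ {ρ} → ρ ∈ R → P ρ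
  forAllRules P h m with ∈R⇒ruleOf m
  ... | k , refl = h k

  data RootClass : Set where
    rEps rOther : RootClass
    rS : Bool → RootClass
    rC : Sy → RootClass
    rK : St → Sy → RootClass

  conClass : Fin (NS * NA) ⊎ Fin NA → RootClass
  conClass (inj₁ x) = rK (proj₁ (remQuot {m = NS} NA x)) (proj₂ (remQuot {m = NS} NA x))
  conClass (inj₂ a) = rC a

  rootClass : Tm → RootClass
  rootClass (A ε _) = rEps
  rootClass (A S₀ _) = rS false
  rootClass (A S₁ _) = rS true
  rootClass (A (con j) _) = conClass (splitAt (NS * NA) j)
  rootClass _ = rOther

  rootClass-Ct : ∀ a w r → rootClass (Ct a w r) ≡ rC a
  rootClass-Ct a w r = ≡cong conClass (splitAt-↑ʳ (NS * NA) NA a)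

  rootClass-Kt : ∀ q a l r → rootClass (Kt q a l r) ≡ rK q a
  rootClass-Kt q a l r = trans (≡cong conClass (splitAt-↑ˡ (NS * NA) (combine q a) NA))
                        (≡cong (λ (p : St × Sy) → rK (proj₁ p) (proj₂ p)) (remQuot-combine q a))

  dChk dConv dMk dOut dWof dStep dG′ : RootClass → Maybe Key
  dChk rEps = just kchkε
  dChk (rS b) = just (kchk b)
  dChk _ = nothing
  dConv rEps = just kconvε
  dConv (rS b) = just (kconv b)
  dConv _ = nothing
  dMk rEps = just kmkε
  dMk (rC a) = just (kmk a)
  dMk _ = nothing
  dOut (rK q a) = just (kout q a)
  dOut _ = nothing
  dWof rEps = just kwofε
  dWof (rC a) = just (kwof a)
  dWof _ = nothing
  dStep (rK q a) = just (kstep q a)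
  dStep _ = nothing
  dG′ rEps = just kg′
  dG′ _ = nothing

  dMvL dMvR : St → RootClass → Maybe Key
  dMvL q rEps = just (kmvLε q)
  dMvL q (rC a) = just (kmvL q a)
  dMvL q _ = nothing
  dMvR q rEps = just (kmvRε q)
  dMvR q (rC a) = just (kmvR q a)
  dMvR q _ = nothing
  dPsh : Sy → RootClass → Maybe Key
  dPsh a rEps = just (kpshε a)
  dPsh a (rC a') = just (kpsh a a')
  dPsh a _ = nothing

  data DigitsShape (n : ℕ) : Set where
    dAll dJunk : DigitsShape n
    dAt : Fin n → Bool → DigitsShape n

  headShape : ∀ {n} → RootClass → DigitsShape (suc n)
  headShape rEps = dAll
  headShape (rS b) = dAt zero b
  headShape _ = dJunk

  consShape : ∀ {n} → Tm → DigitsShape n → DigitsShape (suc n)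
  consShape t dAll = headShape (rootClass t)
  consShape t dJunk = dJunk
  consShape t (dAt j b) = dAt (suc j) b

  digitsShape : ∀ {n} → Vec Tm n → DigitsShape n
  digitsShape [] = dAll
  digitsShape (t ∷ ts) = consShape t (digitsShape ts)

  decodeIter : DigitsShape digits → Maybe Key
  decodeIter dAll = just kiterε
  decodeIter dJunk = nothing
  decodeIter (dAt j b) = just (kiter j b)

  decodeFamily₂ : Fin NS ⊎ Fin NA → RootClass → Maybe Key
  decodeFamily₂ (inj₁ q) = dMvR q
  decodeFamily₂ (inj₂ a) = dPsh a
  decodeFamily : Fin NS ⊎ Fin (NS + NA) → RootClass → Maybe Key
  decodeFamily (inj₁ q) = dMvL q
  decodeFamily (inj₂ x) = decodeFamily₂ (splitAt NS x)

  decodeDef : (i : Fin (9 + (NS + (NS + NA)))) → Vec Tm (defArity i) → Maybe Key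
  decodeDef i0 _ = just kg
  decodeDef i1 (x ∷ y ∷ []) = dG′ (rootClass y)
  decodeDef i2 (x ∷ []) = dChk (rootClass x)
  decodeDef i3 (x ∷ []) = dConv (rootClass x)
  decodeDef i4 (x ∷ []) = dMk (rootClass x)
  decodeDef i5 (x ∷ []) = dOut (rootClass x)
  decodeDef i6 (x ∷ []) = dWof (rootClass x)
  decodeDef i7 (c ∷ x0 ∷ ds) = decodeIter (digitsShape ds)
  decodeDef i8 (x ∷ []) = dStep (rootClass x)
  decodeDef (i9 x) (y ∷ z ∷ []) = decodeFamily (splitAt NS x) (rootClass y)

  -- An instance of a left-hand side determines its rule; hence no two rules overlap.
  decodeKey : Tm → Maybe Key
  decodeKey (A (def i) ts) = decodeDef i ts
  decodeKey _ = nothing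

  substs′-replicate-ε : ∀ n σ → substs′ (replicate n eps) σ ≡ replicate n eps
  substs′-replicate-ε zero σ = refl
  substs′-replicate-ε (suc n) σ = ≡cong (eps ∷_) (substs′-replicate-ε n σ)

  digitsShape-ε : ∀ n → digitsShape (replicate n eps) ≡ dAll
  digitsShape-ε zero = refl
  digitsShape-ε (suc n) = ≡cong (consShape eps) (digitsShape-ε n)

  digitsShape-digitPats : ∀ {n} (v : ℕ → ℕ) (j : Fin n) b σ → digitsShape (substs′ (digitPats v j b) σ) ≡ dAt j b
  digitsShape-digitPats {suc n} v zero b σ rewrite substs′-replicate-ε n σ | digitsShape-ε n with b
  ... | false = refl
  ... | true = refl
  digitsShape-digitPats {suc n} v (suc j) b σ = ≡cong (consShape _) (digitsShape-digitPats (λ m → v (suc m)) j b σ)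

  decodeKey-lhs : ∀ k σ → decodeKey (Rule.lhs (ruleOf k) ⟪ σ ⟫) ≡ just k
  decodeKey-lhs kg σ = refl
  decodeKey-lhs kg′ σ = refl
  decodeKey-lhs kchkε σ = refl
  decodeKey-lhs kconvε σ = refl
  decodeKey-lhs kmkε σ = refl
  decodeKey-lhs kwofε σ = refl
  decodeKey-lhs kiterε σ rewrite substs′-replicate-ε digits σ | digitsShape-ε digits = refl
  decodeKey-lhs (kchk false) σ = refl
  decodeKey-lhs (kchk true) σ = refl
  decodeKey-lhs (kconv false) σ = refl
  decodeKey-lhs (kconv true) σ = refl
  decodeKey-lhs (kmk a) σ rewrite rootClass-Ct a (σ 0) (σ 1) = refl
  decodeKey-lhs (kwof a) σ rewrite rootClass-Ct a (σ 0) (σ 1) = refl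
  decodeKey-lhs (kout q a) σ rewrite rootClass-Kt q a (σ 0) (σ 1) = refl
  decodeKey-lhs (kstep q a) σ rewrite rootClass-Kt q a (σ 0) (σ 1) = refl
  decodeKey-lhs (kiter j b) σ rewrite digitsShape-digitPats digitVar j b σ = refl
  decodeKey-lhs (kmvLε q) σ rewrite splitAt-↑ˡ NS q (NS + NA) = refl
  decodeKey-lhs (kmvRε q) σ rewrite splitAt-↑ʳ NS (NS + NA) (q ↑ˡ NA) | splitAt-↑ˡ NS q NA = refl
  decodeKey-lhs (kmvL q a) σ rewrite splitAt-↑ˡ NS q (NS + NA) | rootClass-Ct a (σ 0) (σ 1) = refl
  decodeKey-lhs (kmvR q a) σ rewrite splitAt-↑ʳ NS (NS + NA) (q ↑ˡ NA) | splitAt-↑ˡ NS q NA | rootClass-Ct a (σ 0) (σ 1) = refl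
  decodeKey-lhs (kpshε a) σ rewrite splitAt-↑ʳ NS (NS + NA) (NS ↑ʳ a) | splitAt-↑ʳ NS NA a = refl
  decodeKey-lhs (kpsh a a') σ rewrite splitAt-↑ʳ NS (NS + NA) (NS ↑ʳ a) | splitAt-↑ʳ NS NA a | rootClass-Ct a' (σ 0) (σ 1) = refl

  lhs-unify⇒≡ : ∀ k₁ k₂ σ₁ σ₂ → Rule.lhs (ruleOf k₁) ⟪ σ₁ ⟫ ≡ Rule.lhs (ruleOf k₂) ⟪ σ₂ ⟫ → k₁ ≡ k₂
  lhs-unify⇒≡ k₁ k₂ σ₁ σ₂ e = just-injective (trans (sym (decodeKey-lhs k₁ σ₁)) (trans (≡cong decodeKey e) (decodeKey-lhs k₂ σ₂)))

  ruleOf-defined : ∀ k → isDefined sig (Rule.fn (ruleOf k)) ≡ true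
  ruleOf-defined kg = refl
  ruleOf-defined kg′ = refl
  ruleOf-defined kchkε = refl
  ruleOf-defined kconvε = refl
  ruleOf-defined kmkε = refl
  ruleOf-defined kwofε = refl
  ruleOf-defined kiterε = refl
  ruleOf-defined (kchk x) = refl
  ruleOf-defined (kconv x) = refl
  ruleOf-defined (kmk x) = refl
  ruleOf-defined (kwof x) = refl
  ruleOf-defined (kout x x₁) = refl
  ruleOf-defined (kstep x x₁) = refl
  ruleOf-defined (kiter x x₁) = refl
  ruleOf-defined (kmvLε x) = refl
  ruleOf-defined (kmvRε x) = refl
  ruleOf-defined (kmvL x x₁) = refl
  ruleOf-defined (kmvR x x₁) = refl
  ruleOf-defined (kpshε x) = refl
  ruleOf-defined (kpsh x x₁) = refl

  IsVal : Tm → Set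
  IsVal = IsValue sig
  eps-value : IsVal eps
  eps-value = IsValue.app refl []
  εs-value : ∀ n → VAll.All IsVal (replicate n eps)
  εs-value zero = []
  εs-value (suc n) = eps-value ∷ εs-value n
  sB-value : ∀ b x → IsVal (sB b (V x))
  sB-value false x = IsValue.app refl (IsValue.var x ∷ [])
  sB-value true x = IsValue.app refl (IsValue.var x ∷ [])
  con₀₁-value : ∀ j → IsVal (A (con j) (V 0 ∷ V 1 ∷ []))
  con₀₁-value j = IsValue.app refl (IsValue.var 0 ∷ IsValue.var 1 ∷ [])
  digitPats-value : ∀ {n} v (j : Fin n) b → VAll.All IsVal (digitPats v j b)
  digitPats-value {suc n} v zero b = sB-value b (v 0) ∷ εs-value n
  digitPats-value {suc n} v (suc j) b = IsValue.var (v 0) ∷ digitPats-value (λ m → v (suc m)) j b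

  ruleOf-patsValues : ∀ k → VAll.All IsVal (Rule.pats (ruleOf k))
  ruleOf-patsValues kg = IsValue.var 0 ∷ []
  ruleOf-patsValues kg′ = IsValue.var 0 ∷ eps-value ∷ []
  ruleOf-patsValues kchkε = eps-value ∷ []
  ruleOf-patsValues kconvε = eps-value ∷ []
  ruleOf-patsValues kmkε = eps-value ∷ []
  ruleOf-patsValues kwofε = eps-value ∷ []
  ruleOf-patsValues kiterε = IsValue.var 0 ∷ IsValue.var 1 ∷ εs-value digits
  ruleOf-patsValues (kchk b) = sB-value b 0 ∷ []
  ruleOf-patsValues (kconv b) = sB-value b 0 ∷ []
  ruleOf-patsValues (kmk a) = con₀₁-value _ ∷ []
  ruleOf-patsValues (kwof a) = con₀₁-value _ ∷ []
  ruleOf-patsValues (kout q a) = con₀₁-value _ ∷ []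
  ruleOf-patsValues (kstep q a) = con₀₁-value _ ∷ []
  ruleOf-patsValues (kiter j b) = IsValue.var 0 ∷ IsValue.var 1 ∷ digitPats-value digitVar j b
  ruleOf-patsValues (kmvLε q) = eps-value ∷ IsValue.var 0 ∷ []
  ruleOf-patsValues (kmvRε q) = eps-value ∷ IsValue.var 0 ∷ []
  ruleOf-patsValues (kmvL q a) = con₀₁-value _ ∷ IsValue.var 2 ∷ []
  ruleOf-patsValues (kmvR q a) = con₀₁-value _ ∷ IsValue.var 2 ∷ []
  ruleOf-patsValues (kpshε a) = eps-value ∷ IsValue.var 0 ∷ []
  ruleOf-patsValues (kpsh a a') = con₀₁-value _ ∷ IsValue.var 2 ∷ []

  con₀₁-linear : ∀ j → Linear (A (con j) (V 0 ∷ V 1 ∷ []))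
  con₀₁-linear j = tt , (tt , tt , λ (_ : ℕ) _ ()) , d01
    where
    d01 : ∀ x → x occ V 0 → ¬ OccursAny x (V 1 ∷ [])
    d01 .0 here (here ())
    d01 .0 here (there ())

  sB-linear : ∀ b x → Linear (sB b (V x))
  sB-linear false x = tt , tt , λ (_ : ℕ) _ ()
  sB-linear true x = tt , tt , λ (_ : ℕ) _ ()

  εs-no-var : ∀ {x} n → ¬ OccursAny x (replicate n eps)
  εs-no-var (suc n) (here (there ()))
  εs-no-var (suc n) (there o) = εs-no-var n o

  εs-linear : ∀ n → LinearArgs (replicate n eps)
  εs-linear zero = tt
  εs-linear (suc n) = tt , εs-linear n , λ { x (there ()) _ }

  digitPats-vars : ∀ {n x} v (j : Fin n) b → OccursAny x (digitPats v j b) → Σ ℕ λ m → x ≡ v m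
  digitPats-vars {suc n} v zero false (here (there (here here))) = 0 , refl
  digitPats-vars {suc n} v zero true (here (there (here here))) = 0 , refl
  digitPats-vars {suc n} v zero false (here (there (there ())))
  digitPats-vars {suc n} v zero true (here (there (there ())))
  digitPats-vars {suc n} v zero b (there o) = ⊥-elim (εs-no-var n o)
  digitPats-vars {suc n} v (suc j) b (here here) = 0 , refl
  digitPats-vars {suc n} v (suc j) b (there o) with digitPats-vars (λ m → v (suc m)) j b o
  ... | m , e = suc m , e

  digitPats-linear : ∀ {n} v (j : Fin n) b → (∀ m m' → v m ≡ v m' → m ≡ m') → LinearArgs (digitPats v j b)
  digitPats-linear {suc n} v zero b inj = sB-linear b (v 0) , εs-linear n , λ x _ o → εs-no-var n o
  digitPats-linear {suc n} v (suc j) b inj = tt , digitPats-linear (λ m → v (suc m)) j b (λ m m' e → suc-injective (inj _ _ e)) , d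
    where
    d : ∀ x → x occ V (v 0) → ¬ OccursAny x (digitPats (λ m → v (suc m)) j b)
    d .(v 0) here o with digitPats-vars (λ m → v (suc m)) j b o
    ... | m , e = 0≢1+n (inj _ _ e)

  digitVar-injective : ∀ m m' → digitVar m ≡ digitVar m' → m ≡ m'
  digitVar-injective m .m refl = refl

  digitVar≢0,1 : ∀ {x} → x ≡ 0 ⊎ x ≡ 1 → ∀ m → x ≡ digitVar m → ⊥
  digitVar≢0,1 (inj₁ refl) m ()
  digitVar≢0,1 (inj₂ refl) m ()

  iter-pats-linear : ∀ {ds : Vec Tm digits} → LinearArgs ds → (∀ {x} → OccursAny x ds → Σ ℕ λ m → x ≡ digitVar m) → LinearArgs (V 0 ∷ V 1 ∷ ds)
  iter-pats-linear {ds} l oc = tt , (tt , l , d1) , d0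
    where
    d1 : ∀ x → x occ V 1 → ¬ OccursAny x ds
    d1 .1 here o with oc o
    ... | m , e = digitVar≢0,1 (inj₂ refl) m e
    d0 : ∀ x → x occ V 0 → ¬ OccursAny x (V 1 ∷ ds)
    d0 .0 here (here ())
    d0 .0 here (there o) with oc o
    ... | m , e = digitVar≢0,1 (inj₁ refl) m e

  Ct₀₁-apart-2 : ∀ a x → x occ Ct a (V 0) (V 1) → ¬ OccursAny x (V 2 ∷ [])
  Ct₀₁-apart-2 a x (there (here here)) (here ())
  Ct₀₁-apart-2 a x (there (there (here here))) (here ())
  Ct₀₁-apart-2 a x _ (there ())

  ruleOf-patsLinear : ∀ k → LinearArgs (Rule.pats (ruleOf k))
  ruleOf-patsLinear kg = tt , tt , λ (_ : ℕ) _ ()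
  ruleOf-patsLinear kg′ = tt , (tt , tt , λ (_ : ℕ) _ ()) , λ { x here (here (there ())) ; x here (there ()) }
  ruleOf-patsLinear kchkε = tt , tt , λ (_ : ℕ) _ ()
  ruleOf-patsLinear kconvε = tt , tt , λ (_ : ℕ) _ ()
  ruleOf-patsLinear kmkε = tt , tt , λ (_ : ℕ) _ ()
  ruleOf-patsLinear kwofε = tt , tt , λ (_ : ℕ) _ ()
  ruleOf-patsLinear kiterε = iter-pats-linear (εs-linear digits) (λ o → ⊥-elim (εs-no-var digits o))
  ruleOf-patsLinear (kchk b) = sB-linear b 0 , tt , λ (_ : ℕ) _ ()
  ruleOf-patsLinear (kconv b) = sB-linear b 0 , tt , λ (_ : ℕ) _ ()
  ruleOf-patsLinear (kmk a) = con₀₁-linear ((NS * NA) ↑ʳ a) , tt , λ (_ : ℕ) _ ()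
  ruleOf-patsLinear (kwof a) = con₀₁-linear ((NS * NA) ↑ʳ a) , tt , λ (_ : ℕ) _ ()
  ruleOf-patsLinear (kout q a) = con₀₁-linear (combine q a ↑ˡ NA) , tt , λ (_ : ℕ) _ ()
  ruleOf-patsLinear (kstep q a) = con₀₁-linear (combine q a ↑ˡ NA) , tt , λ (_ : ℕ) _ ()
  ruleOf-patsLinear (kiter j b) = iter-pats-linear (digitPats-linear digitVar j b digitVar-injective) (digitPats-vars digitVar j b)
  ruleOf-patsLinear (kmvLε q) = tt , (tt , tt , λ (_ : ℕ) _ ()) , λ { x (there ()) _ }
  ruleOf-patsLinear (kmvRε q) = tt , (tt , tt , λ (_ : ℕ) _ ()) , λ { x (there ()) _ }
  ruleOf-patsLinear (kpshε a) = tt , (tt , tt , λ (_ : ℕ) _ ()) , λ { x (there ()) _ }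
  ruleOf-patsLinear (kmvL q a) = con₀₁-linear ((NS * NA) ↑ʳ a) , (tt , tt , λ (_ : ℕ) _ ()) , Ct₀₁-apart-2 a
  ruleOf-patsLinear (kmvR q a) = con₀₁-linear ((NS * NA) ↑ʳ a) , (tt , tt , λ (_ : ℕ) _ ()) , Ct₀₁-apart-2 a
  ruleOf-patsLinear (kpsh a a') = con₀₁-linear ((NS * NA) ↑ʳ a') , (tt , tt , λ (_ : ℕ) _ ()) , Ct₀₁-apart-2 a'

  All-vars-replicate : ∀ n {y} {P : ℕ → Set} → P y → LAll.All P (varsArgs (replicate n (V y)))
  All-vars-replicate zero p = []
  All-vars-replicate (suc n) p = p ∷ All-vars-replicate n p

  All-vars-stepTⁿ : ∀ n {P : ℕ → Set} → P 0 → LAll.All P (vars (stepTⁿ n (V 0)))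
  All-vars-stepTⁿ zero p = p ∷ []
  All-vars-stepTⁿ (suc n) p = LAllP.++⁺ (All-vars-stepTⁿ n p) []

  digitsDecremented-vars : ∀ {n} v (j : Fin n) b → LAll.All (λ x → x ≡ 1 ⊎ OccursAny x (digitPats v j b)) (varsArgs (digitsDecremented v j))
  digitsDecremented-vars {suc n} v zero false = inj₂ (here (there (here here))) ∷ All-vars-replicate n (inj₁ refl)
  digitsDecremented-vars {suc n} v zero true = inj₂ (here (there (here here))) ∷ All-vars-replicate n (inj₁ refl)
  digitsDecremented-vars {suc n} v (suc j) b = inj₂ (here here) ∷
    LAll.map (λ { (inj₁ e) → inj₁ e ; (inj₂ o) → inj₂ (there o) }) (digitsDecremented-vars (λ m → v (suc m)) j b)

  0∈lhs-psh : ∀ {a a'} → 0 occ Rule.lhs (ruleOf (kpsh a a'))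
  0∈lhs-psh = there (here (there (here here)))

  1∈lhs-psh : ∀ {a a'} → 1 occ Rule.lhs (ruleOf (kpsh a a'))
  1∈lhs-psh = there (here (there (there (here here))))

  ruleOf-isRule : ∀ k → IsRule sig (ruleOf k)
  ruleOf-isRule kg = vars⊆lhs _ _ (there (here here) ∷ there (here here) ∷ [])
  ruleOf-isRule kg′ = vars⊆lhs _ _ (there (here here) ∷ there (here here) ∷ LAllP.++⁺ (All-vars-replicate digits (there (here here))) [])
  ruleOf-isRule kchkε = vars⊆lhs _ _ []
  ruleOf-isRule kconvε = vars⊆lhs _ _ []
  ruleOf-isRule kmkε = vars⊆lhs _ _ []
  ruleOf-isRule kwofε = vars⊆lhs _ _ []
  ruleOf-isRule kiterε = vars⊆lhs _ _ (All-vars-stepTⁿ blockSteps (there (here here)))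
  ruleOf-isRule (kchk false) = vars⊆lhs _ _ (there (here (there (here here))) ∷ [])
  ruleOf-isRule (kchk true) = vars⊆lhs _ _ (there (here (there (here here))) ∷ [])
  ruleOf-isRule (kconv false) = vars⊆lhs _ _ (there (here (there (here here))) ∷ [])
  ruleOf-isRule (kconv true) = vars⊆lhs _ _ (there (here (there (here here))) ∷ [])
  ruleOf-isRule (kmk a) = vars⊆lhs _ _ (there (here (there (there (here here)))) ∷ [])
  ruleOf-isRule (kwof a) = vars⊆lhs _ _ (there (here (there (here here))) ∷ [])
  ruleOf-isRule (kout q zero) = vars⊆lhs _ _ []
  ruleOf-isRule (kout q (suc zero)) = vars⊆lhs _ _ (there (here (there (there (here here)))) ∷ [])
  ruleOf-isRule (kout q (suc (suc zero))) = vars⊆lhs _ _ (there (here (there (there (here here)))) ∷ [])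
  ruleOf-isRule (kout q (suc (suc (suc a)))) = vars⊆lhs _ _ []
  ruleOf-isRule (kiter j b) = vars⊆lhs _ _ (LAllP.++⁺ (there (here here) ∷ there (there (here here)) ∷ rd) (there (there (here here)) ∷ rd))
    where
    rd : LAll.All (_occ Rule.lhs (ruleOf (kiter j b))) (varsArgs (digitsDecremented digitVar j))
    rd = LAll.map (λ { (inj₁ refl) → there (there (here here)) ; (inj₂ o) → there (there (there o)) }) (digitsDecremented-vars digitVar j b)
  ruleOf-isRule (kstep q a) with δ q a
  ... | nothing = vars⊆lhs _ _ (there (here (there (here here))) ∷ there (here (there (there (here here)))) ∷ [])
  ... | just (q' , b , stay) = vars⊆lhs _ _ (there (here (there (here here))) ∷ there (here (there (there (here here)))) ∷ [])
  ... | just (q' , b , left) = vars⊆lhs _ _ (there (here (there (here here))) ∷ there (here (there (there (here here)))) ∷ [])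
  ... | just (q' , b , right) = vars⊆lhs _ _ (there (here (there (there (here here)))) ∷ there (here (there (here here))) ∷ [])
  ruleOf-isRule (kmvLε q) = vars⊆lhs _ _ (there (there (here here)) ∷ [])
  ruleOf-isRule (kmvRε q) = vars⊆lhs _ _ (there (there (here here)) ∷ [])
  ruleOf-isRule (kmvL q a) = vars⊆lhs _ _ (there (here (there (there (here here)))) ∷ there (there (here here)) ∷ [])
  ruleOf-isRule (kmvR q a) = vars⊆lhs _ _ (there (there (here here)) ∷ there (here (there (there (here here)))) ∷ [])
  ruleOf-isRule (kpshε zero) = vars⊆lhs _ _ []
  ruleOf-isRule (kpshε (suc zero)) = vars⊆lhs _ _ []
  ruleOf-isRule (kpshε (suc (suc zero))) = vars⊆lhs _ _ []
  ruleOf-isRule (kpshε (suc (suc (suc a)))) = vars⊆lhs _ _ []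
  ruleOf-isRule (kpsh zero a') = vars⊆lhs _ _ (0∈lhs-psh ∷ 1∈lhs-psh ∷ [])
  ruleOf-isRule (kpsh (suc zero) a') = vars⊆lhs _ _ (0∈lhs-psh ∷ 0∈lhs-psh ∷ 1∈lhs-psh ∷ [])
  ruleOf-isRule (kpsh (suc (suc zero)) a') = vars⊆lhs _ _ (0∈lhs-psh ∷ 0∈lhs-psh ∷ 1∈lhs-psh ∷ [])
  ruleOf-isRule (kpsh (suc (suc (suc a))) a') = vars⊆lhs _ _ (0∈lhs-psh ∷ 1∈lhs-psh ∷ [])

  non-overlapping : ∀ {ρ₁ ρ₂ σ₁ σ₂} → ρ₁ ∈ R → ρ₂ ∈ R → Rule.lhs ρ₁ ⟪ σ₁ ⟫ ≡ Rule.lhs ρ₂ ⟪ σ₂ ⟫ → ρ₁ ≡ ρ₂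
  non-overlapping {σ₁ = σ₁} {σ₂} m₁ m₂ e with ∈R⇒ruleOf m₁ | ∈R⇒ruleOf m₂
  ... | k₁ , refl | k₂ , refl = ≡cong ruleOf (lhs-unify⇒≡ k₁ k₂ σ₁ σ₂ e)

  module Orth = Orthogonal R
      (forAllRules (λ ρ → isDefined sig (Rule.fn ρ) ≡ true) ruleOf-defined)
      (forAllRules (λ ρ → VAll.All IsVal (Rule.pats ρ)) ruleOf-patsValues)
      (forAllRules (λ ρ → LinearArgs (Rule.pats ρ)) ruleOf-patsLinear)
      (forAllRules (IsRule sig) ruleOf-isRule)
      non-overlapping

  confluentR : Confluent sig R
  confluentR = Orth.confluent

  constructorTRS : ConstructorTRS sig R
  constructorTRS = LAll.tabulate (forAllRules (IsConstructorRule sig) λ k → ruleOf-isRule k , ruleOf-defined k , ruleOf-patsValues k)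


module MachineOrder (M : TM) (cc kk : ℕ) where
  open TM M
  open MachineTRS M cc kk

  defRank : Fin (9 + (NS + (NS + NA))) → ℕ
  defRank i0 = 6
  defRank i1 = 5
  defRank i2 = 1
  defRank i3 = 2
  defRank i4 = 2
  defRank i5 = 4
  defRank i6 = 1
  defRank i7 = 3
  defRank i8 = 2
  defRank (i9 _) = 1

  rank : FS → ℕ
  rank (def i) = defRank i
  rank _ = 0

  defRank≥1 : ∀ i → 1 ≤ defRank i
  defRank≥1 i0 = s≤s z≤n
  defRank≥1 i1 = s≤s z≤n
  defRank≥1 i2 = s≤s z≤n
  defRank≥1 i3 = s≤s z≤n
  defRank≥1 i4 = s≤s z≤n
  defRank≥1 i5 = s≤s z≤n
  defRank≥1 i6 = s≤s z≤n
  defRank≥1 i7 = s≤s z≤n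
  defRank≥1 i8 = s≤s z≤n
  defRank≥1 (i9 _) = s≤s z≤n

  precedence : QuasiPrecedence sig
  precedence = rankPrecedence rank

  open QuasiPrecedence precedence using (_≻_; _∼_)

  admissible : Admissible sig precedence
  admissible (def i) ε _ _ = z≤n , λ p → <⇒≱ (defRank≥1 i) p
  admissible (def i) S₀ _ _ = z≤n , λ p → <⇒≱ (defRank≥1 i) p
  admissible (def i) S₁ _ _ = z≤n , λ p → <⇒≱ (defRank≥1 i) p
  admissible (def i) (con j) _ _ = z≤n , λ p → <⇒≱ (defRank≥1 i) p
  admissible (def i) (def j) _ ()
  admissible ε _ () _
  admissible S₀ _ () _
  admissible S₁ _ () _
  admissible (con _) _ () _

  safeMap : SafeMapping sig
  safeMap i0 _ = false
  safeMap i1 zero = false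
  safeMap i1 (suc _) = true
  safeMap i2 _ = false
  safeMap i3 _ = false
  safeMap i4 _ = true
  safeMap i5 _ = true
  safeMap i6 _ = true
  safeMap i7 zero = true
  safeMap i7 (suc _) = false
  safeMap i8 _ = true
  safeMap (i9 _) _ = true

  open EPO sig precedence safeMap

  ≻-byRank : ∀ f g {p : True (rank g <? rank f)} → f ≻ g
  ≻-byRank f g {p} = <⇒≤ (toWitness p) , <⇒≱ (toWitness p)

  ∼-refl : ∀ {f} → f ∼ f
  ∼-refl = ≤-refl , ≤-refl

  select-all : ∀ {n} (p : Fin n → Bool) → (∀ i → p i ≡ true) → (ts : Vec Tm n) → select p ts ≡ toList ts
  select-all p h [] = refl
  select-all p h (t ∷ ts) with p zero | h zero
  ... | .true | refl = ≡cong (t ∷_) (select-all _ (λ i → h (suc i)) ts)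

  select-none : ∀ {n} (p : Fin n → Bool) → (∀ i → p i ≡ false) → (ts : Vec Tm n) → select p ts ≡ []
  select-none p h [] = refl
  select-none p h (t ∷ ts) with p zero | h zero
  ... | .false | refl = select-none _ (λ i → h (suc i)) ts

  nargs-iterT : ∀ c x0 (ds : Vec Tm digits) → nargs iterS (c ∷ x0 ∷ ds) ≡ x0 ∷ toList ds
  nargs-iterT c x0 ds = ≡cong (x0 ∷_) (select-all _ (λ i → refl) ds)

  sargs-iterT : ∀ c x0 (ds : Vec Tm digits) → sargs iterS (c ∷ x0 ∷ ds) ≡ c ∷ []
  sargs-iterT c x0 ds = ≡cong (c ∷_) (select-none _ (λ i → refl) ds)

  digitPrefix : ∀ {n} → (ℕ → ℕ) → Fin n → List Tm
  digitPrefix v zero = []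
  digitPrefix v (suc j) = V (v 0) ∷ digitPrefix (λ m → v (suc m)) j

  digitVarAt : ∀ {n} → (ℕ → ℕ) → Fin n → ℕ
  digitVarAt v zero = v 0
  digitVarAt v (suc j) = digitVarAt (λ m → v (suc m)) j

  digitSuffix : ∀ {n} → Fin n → Tm → List Tm
  digitSuffix {suc n} zero t = toList (replicate n t)
  digitSuffix (suc j) t = digitSuffix j t

  digitPats-split : ∀ {n} v (j : Fin n) b → toList (digitPats v j b) ≡ digitPrefix v j ++ sB b (V (digitVarAt v j)) ∷ digitSuffix j eps
  digitPats-split v zero b = refl
  digitPats-split v (suc j) b = ≡cong (V (v 0) ∷_) (digitPats-split (λ m → v (suc m)) j b)

  digitsDecremented-split : ∀ {n} v (j : Fin n) → toList (digitsDecremented v j) ≡ digitPrefix v j ++ V (digitVarAt v j) ∷ digitSuffix j (V 1)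
  digitsDecremented-split v zero = refl
  digitsDecremented-split v (suc j) = ≡cong (V (v 0) ∷_) (digitsDecremented-split (λ m → v (suc m)) j)

  All-replicate : ∀ n {Q : Tm → Set} {t} → Q t → LAll.All Q (toList (replicate n t))
  All-replicate zero q = []
  All-replicate (suc n) q = q ∷ All-replicate n q

  All-digitSuffix : ∀ {n} (j : Fin n) {Q : Tm → Set} {t} → Q t → LAll.All Q (digitSuffix j t)
  All-digitSuffix {suc n} zero q = All-replicate n q
  All-digitSuffix (suc j) q = All-digitSuffix j q

  sB▷*var : ∀ b x → sB b (V x) ▷* V x
  sB▷*var false x = sub zero refl (inj₂ refl≈)
  sB▷*var true x = sub zero refl (inj₂ refl≈)

  module IterRule (j : Fin digits) (b : Bool) where
    iterLhs : Tm
    iterLhs = iterT (V 0) (V 1) (digitPats digitVar j b)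

    iterLhs▷*V1 : iterLhs ▷* V 1
    iterLhs▷*V1 = sub (suc zero) refl (inj₂ refl≈)

    iterT-decreasing : ∀ c → iterLhs >epo c → iterLhs >epo iterT c (V 1) (digitsDecremented digitVar j)
    iterT-decreasing c h = epo3 (∼-refl {iterS}) (V 1 ∷ digitPrefix digitVar j) (sB b (V (digitVarAt digitVar j))) (digitSuffix j eps)
                        (V 1 ∷ digitPrefix digitVar j) (V (digitVarAt digitVar j)) (digitSuffix j (V 1))
                        (trans (nargs-iterT (V 0) (V 1) (digitPats digitVar j b)) (≡cong (V 1 ∷_) (digitPats-split digitVar j b)))
                        (trans (nargs-iterT c (V 1) (digitsDecremented digitVar j)) (≡cong (V 1 ∷_) (digitsDecremented-split digitVar j)))
                        (ListPW.refl refl≈) (sB▷*var b _) (All-digitSuffix j iterLhs▷*V1)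
                        (subst (LAll.All (iterLhs >epo_)) (sym (sargs-iterT c (V 1) (digitsDecremented digitVar j))) (h ∷ []))

    decreasing : iterLhs >epo iterT (iterT (V 0) (V 1) (digitsDecremented digitVar j)) (V 1) (digitsDecremented digitVar j)
    decreasing = iterT-decreasing _ (iterT-decreasing (V 0) (epo1 (here (inj₂ refl≈))))

  iterT>stepTⁿ : ∀ n {ds : Vec Tm digits} → iterT (V 0) (V 1) ds >epo stepTⁿ n (V 0) ⊎ stepTⁿ n (V 0) ≡ V 0
  iterT>stepTⁿ zero = inj₂ refl
  iterT>stepTⁿ (suc n) with iterT>stepTⁿ n
  ... | inj₁ g = inj₁ (epo2 (≻-byRank iterS stepS) [] (g ∷ []))
  ... | inj₂ e rewrite e = inj₁ (epo2 (≻-byRank iterS stepS) [] (epo1 (here (inj₂ refl≈)) ∷ []))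

  ruleOf-decreasing : ∀ k → Rule.lhs (ruleOf k) >epo Rule.rhs (ruleOf k)
  ruleOf-decreasing kg = epo2 (≻-byRank gS g′S) (sub zero refl (inj₂ refl≈) ∷ []) (epo2 (≻-byRank gS chkS) (sub zero refl (inj₂ refl≈) ∷ []) [] ∷ [])
  ruleOf-decreasing kg′ = epo2 (≻-byRank g′S outS) [] (iter-decreasing ∷ [])
    where
    v0 : Rule.lhs (ruleOf kg′) ▷* V 0
    v0 = sub zero refl (inj₂ refl≈)
    iter-decreasing : Rule.lhs (ruleOf kg′) >epo iterT (mkT (convT (V 0))) (V 0) (replicate digits (V 0))
    iter-decreasing = epo2 (≻-byRank g′S iterS)
            (subst (LAll.All (Rule.lhs (ruleOf kg′) ▷*_)) (sym (nargs-iterT (mkT (convT (V 0))) (V 0) (replicate digits (V 0)))) (v0 ∷ All-replicate digits v0))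
            (subst (LAll.All (Rule.lhs (ruleOf kg′) >epo_)) (sym (sargs-iterT (mkT (convT (V 0))) (V 0) (replicate digits (V 0))))
              (epo2 (≻-byRank g′S mkS) [] (epo2 (≻-byRank g′S convS) (v0 ∷ []) [] ∷ []) ∷ []))
  ruleOf-decreasing kchkε = epo2 (≻-byRank chkS ε) [] []
  ruleOf-decreasing kconvε = epo2 (≻-byRank convS ε) [] []
  ruleOf-decreasing kmkε = epo2 (≻-byRank mkS (KS start blankS)) [] (epo2 (≻-byRank mkS ε) [] [] ∷ epo2 (≻-byRank mkS ε) [] [] ∷ [])
  ruleOf-decreasing kwofε = epo2 (≻-byRank wofS ε) [] []
  ruleOf-decreasing kiterε with iterT>stepTⁿ blockSteps {replicate digits eps}
  ... | inj₁ g = g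
  ... | inj₂ e = subst (Rule.lhs (ruleOf kiterε) >epo_) (sym e) (epo1 (here (inj₂ refl≈)))
  ruleOf-decreasing (kchk false) = epo3 (∼-refl {chkS}) [] _ [] [] (V 0) [] refl refl [] (sub zero refl (inj₂ refl≈)) [] []
  ruleOf-decreasing (kchk true) = epo3 (∼-refl {chkS}) [] _ [] [] (V 0) [] refl refl [] (sub zero refl (inj₂ refl≈)) [] []
  ruleOf-decreasing (kconv false) = epo2 (≻-byRank convS (pshS (bitSym M false))) []
    (epo3 (∼-refl {convS}) [] _ [] [] (V 0) [] refl refl [] (sub zero refl (inj₂ refl≈)) [] [] ∷ epo2 (≻-byRank convS ε) [] [] ∷ [])
  ruleOf-decreasing (kconv true) = epo2 (≻-byRank convS (pshS (bitSym M true))) []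
    (epo3 (∼-refl {convS}) [] _ [] [] (V 0) [] refl refl [] (sub zero refl (inj₂ refl≈)) [] [] ∷ epo2 (≻-byRank convS ε) [] [] ∷ [])
  ruleOf-decreasing (kmk a) = epo2 (≻-byRank mkS (KS start a)) [] (epo2 (≻-byRank mkS ε) [] [] ∷ epo1 (here (inj₁ (epo1 (there (here (inj₂ refl≈)))))) ∷ [])
  ruleOf-decreasing (kwof a) = epo1 (here (inj₁ (epo1 (here (inj₂ refl≈)))))
  ruleOf-decreasing (kout q zero) = epo2 (≻-byRank outS ε) [] []
  ruleOf-decreasing (kout q (suc zero)) = epo2 (≻-byRank outS S₀) [] (epo2 (≻-byRank outS wofS) [] (epo1 (here (inj₁ (epo1 (there (here (inj₂ refl≈)))))) ∷ []) ∷ [])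
  ruleOf-decreasing (kout q (suc (suc zero))) = epo2 (≻-byRank outS S₁) [] (epo2 (≻-byRank outS wofS) [] (epo1 (here (inj₁ (epo1 (there (here (inj₂ refl≈)))))) ∷ []) ∷ [])
  ruleOf-decreasing (kout q (suc (suc (suc a)))) = epo2 (≻-byRank outS ε) [] []
  ruleOf-decreasing (kiter j b) = IterRule.decreasing j b
  ruleOf-decreasing (kstep q a) with δ q a
  ... | nothing = epo1 (here (inj₂ refl≈))
  ... | just (q' , b , stay) = epo2 (≻-byRank stepS (KS q' b)) [] (epo1 (here (inj₁ (epo1 (here (inj₂ refl≈))))) ∷ epo1 (here (inj₁ (epo1 (there (here (inj₂ refl≈)))))) ∷ [])
  ... | just (q' , b , left) = epo2 (≻-byRank stepS (mvLS q')) [] (epo1 (here (inj₁ (epo1 (here (inj₂ refl≈))))) ∷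
          epo2 (≻-byRank stepS (pshS b)) [] (epo1 (here (inj₁ (epo1 (there (here (inj₂ refl≈)))))) ∷ epo2 (≻-byRank stepS ε) [] [] ∷ []) ∷ [])
  ... | just (q' , b , right) = epo2 (≻-byRank stepS (mvRS q')) [] (epo1 (here (inj₁ (epo1 (there (here (inj₂ refl≈)))))) ∷
          epo2 (≻-byRank stepS (pshS b)) [] (epo1 (here (inj₁ (epo1 (here (inj₂ refl≈))))) ∷ epo2 (≻-byRank stepS ε) [] [] ∷ []) ∷ [])
  ruleOf-decreasing (kmvLε q) = epo2 (≻-byRank (mvLS q) (KS q blankS)) [] (epo2 (≻-byRank (mvLS q) ε) [] [] ∷ epo1 (there (here (inj₂ refl≈))) ∷ [])
  ruleOf-decreasing (kmvRε q) = epo2 (≻-byRank (mvRS q) (KS q blankS)) [] (epo1 (there (here (inj₂ refl≈))) ∷ epo2 (≻-byRank (mvRS q) ε) [] [] ∷ [])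
  ruleOf-decreasing (kmvL q a) = epo2 (≻-byRank (mvLS q) (KS q a)) [] (epo1 (here (inj₁ (epo1 (there (here (inj₂ refl≈)))))) ∷ epo1 (there (here (inj₂ refl≈))) ∷ [])
  ruleOf-decreasing (kmvR q a) = epo2 (≻-byRank (mvRS q) (KS q a)) [] (epo1 (there (here (inj₂ refl≈))) ∷ epo1 (here (inj₁ (epo1 (there (here (inj₂ refl≈)))))) ∷ [])
  ruleOf-decreasing (kpshε zero) = epo2 (≻-byRank (pshS zero) (CS zero)) [] (epo2 (≻-byRank (pshS zero) ε) [] [] ∷ epo2 (≻-byRank (pshS zero) ε) [] [] ∷ [])
  ruleOf-decreasing (kpshε (suc zero)) = epo2 (≻-byRank (pshS (suc zero)) (CS (suc zero))) []
    (epo2 (≻-byRank (pshS (suc zero)) S₀) [] (epo2 (≻-byRank (pshS (suc zero)) ε) [] [] ∷ []) ∷ epo2 (≻-byRank (pshS (suc zero)) ε) [] [] ∷ [])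
  ruleOf-decreasing (kpshε (suc (suc zero))) = epo2 (≻-byRank (pshS (suc (suc zero))) (CS (suc (suc zero)))) []
    (epo2 (≻-byRank (pshS (suc (suc zero))) S₁) [] (epo2 (≻-byRank (pshS (suc (suc zero))) ε) [] [] ∷ []) ∷ epo2 (≻-byRank (pshS (suc (suc zero))) ε) [] [] ∷ [])
  ruleOf-decreasing (kpshε (suc (suc (suc a)))) = epo2 (≻-byRank (pshS (suc (suc (suc a)))) (CS (suc (suc (suc a))))) []
    (epo2 (≻-byRank (pshS (suc (suc (suc a)))) ε) [] [] ∷ epo2 (≻-byRank (pshS (suc (suc (suc a)))) ε) [] [] ∷ [])
  ruleOf-decreasing (kpsh zero a') = epo2 (≻-byRank (pshS zero) (CS zero)) [] (epo2 (≻-byRank (pshS zero) ε) [] [] ∷ epo1 (here (inj₂ refl≈)) ∷ [])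
  ruleOf-decreasing (kpsh (suc zero) a') = epo2 (≻-byRank (pshS (suc zero)) (CS (suc zero))) []
    (epo2 (≻-byRank (pshS (suc zero)) S₀) [] (epo1 (here (inj₁ (epo1 (here (inj₂ refl≈))))) ∷ []) ∷ epo1 (here (inj₂ refl≈)) ∷ [])
  ruleOf-decreasing (kpsh (suc (suc zero)) a') = epo2 (≻-byRank (pshS (suc (suc zero))) (CS (suc (suc zero)))) []
    (epo2 (≻-byRank (pshS (suc (suc zero))) S₁) [] (epo1 (here (inj₁ (epo1 (here (inj₂ refl≈))))) ∷ []) ∷ epo1 (here (inj₂ refl≈)) ∷ [])
  ruleOf-decreasing (kpsh (suc (suc (suc a))) a') = epo2 (≻-byRank (pshS (suc (suc (suc a)))) (CS (suc (suc (suc a))))) []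
    (epo2 (≻-byRank (pshS (suc (suc (suc a)))) ε) [] [] ∷ epo1 (here (inj₂ refl≈)) ∷ [])

  compatible : Compatible R
  compatible = LAll.tabulate (forAllRules (λ ρ → Rule.lhs ρ >epo Rule.rhs ρ) ruleOf-decreasing)


module Simulation (M : TM) (cc kk : ℕ) where
  open TM M
  open MachineTRS M cc kk
  open Rewriting R

  infix 4 _⇒_ _⇒*_
  _⇒_ : Tm → Tm → Set
  _⇒_ = _⟶ᵢ'_
  _⇒*_ : Tm → Tm → Set
  _⇒*_ = _⟶ᵢ*'_

  mutual
    value-irreducible : ∀ {t} → IsVal t → ∀ {u} → ¬ (t ⟶' u)
    value-irreducible v (_⟶_.root {ρ} m σ) with ∈R⇒ruleOf m
    value-irreducible (IsValue.app e _) (_⟶_.root {ρ} m σ) | k , refl with trans (sym e) (ruleOf-defined k)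
    ... | ()
    value-irreducible (IsValue.app e vs) (_⟶_.cong i p) = values-irreducible vs i p

    values-irreducible : ∀ {n} {ts : Vec Tm n} → VAll.All IsVal ts → ∀ i {u} → ¬ (lookup ts i ⟶' u)
    values-irreducible (v ∷ vs) zero p = value-irreducible v p
    values-irreducible (v ∷ vs) (suc i) p = values-irreducible vs i p

  value-NF : ∀ {t} → IsVal t → NF' t
  value-NF v u p = value-irreducible v p

  rootStep : ∀ k (σ : Subst sig) {s t} → s ≡ Rule.lhs (ruleOf k) ⟪ σ ⟫ → Rule.rhs (ruleOf k) ⟪ σ ⟫ ≡ t →
       VAll.All IsVal (substs′ (Rule.pats (ruleOf k)) σ) → s ⇒* t
  rootStep k σ refl refl vs = _⟶ᵢ_.root (ruleOf∈R k) σ (VAll.map value-NF vs) ◅ ε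

  substList : List Tm → Subst sig
  substList [] _ = eps
  substList (t ∷ ts) zero = t
  substList (t ∷ ts) (suc n) = substList ts n

  encW : List Bool → Tm
  encW = enc sig

  bits : List Sy → List Bool
  bits = readWord M

  encTape : List Sy → Tm
  encTape [] = eps
  encTape (a ∷ rs) = Ct a (encW (bits (a ∷ rs))) (encTape rs)

  Cf : Set
  Cf = Config M

  encConf : Cf → Tm
  encConf (conf q ls a rs) = Kt q a (encTape ls) (encTape rs)

  encW-value : ∀ w → IsVal (encW w)
  encW-value [] = eps-value
  encW-value (false ∷ w) = IsValue.app refl (encW-value w ∷ [])
  encW-value (true ∷ w) = IsValue.app refl (encW-value w ∷ [])

  encTape-value : ∀ xs → IsVal (encTape xs)
  encTape-value [] = eps-value
  encTape-value (a ∷ xs) = IsValue.app refl (encW-value _ ∷ encTape-value xs ∷ [])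

  encConf-value : ∀ c → IsVal (encConf c)
  encConf-value (conf q ls a rs) = IsValue.app refl (encTape-value ls ∷ encTape-value rs ∷ [])

  bw-bits : ∀ a xs → bw a (encW (bits xs)) ≡ encW (bits (a ∷ xs))
  bw-bits zero xs = refl
  bw-bits (suc zero) xs = refl
  bw-bits (suc (suc zero)) xs = refl
  bw-bits (suc (suc (suc a))) xs = refl

  bw-⟪⟫ : ∀ a t σ → (bw a t) ⟪ σ ⟫ ≡ bw a (t ⟪ σ ⟫)
  bw-⟪⟫ zero t σ = refl
  bw-⟪⟫ (suc zero) t σ = refl
  bw-⟪⟫ (suc (suc zero)) t σ = refl
  bw-⟪⟫ (suc (suc (suc a))) t σ = refl

  bw-⇒* : ∀ a {t u} → t ⇒* u → bw a t ⇒* bw a u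
  bw-⇒* zero p = ε
  bw-⇒* (suc zero) p = ⟶ᵢ*-arg zero p
  bw-⇒* (suc (suc zero)) p = ⟶ᵢ*-arg zero p
  bw-⇒* (suc (suc (suc a))) p = ε

  psh-evaluates : ∀ a rs → A (pshS a) (encTape rs ∷ eps ∷ []) ⇒* encTape (a ∷ rs)
  psh-evaluates a [] = rootStep (kpshε a) (substList (eps ∷ [])) refl (≡cong (λ z → Ct a z eps) (trans (bw-⟪⟫ a eps _) (bw-bits a [])))
                 (eps-value ∷ eps-value ∷ [])
  psh-evaluates a (r ∷ xs) = rootStep (kpsh a r) (substList (encW (bits (r ∷ xs)) ∷ encTape xs ∷ eps ∷ [])) refl
                 (≡cong (λ z → Ct a z (encTape (r ∷ xs))) (trans (bw-⟪⟫ a (V 0) _) (bw-bits a (r ∷ xs))))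
                 (encTape-value (r ∷ xs) ∷ eps-value ∷ [])

  wof-evaluates : ∀ xs → wofT (encTape xs) ⇒* encW (bits xs)
  wof-evaluates [] = rootStep kwofε (substList []) refl refl (eps-value ∷ [])
  wof-evaluates (a ∷ xs) = rootStep (kwof a) (substList (encW (bits (a ∷ xs)) ∷ encTape xs ∷ [])) refl refl (encTape-value (a ∷ xs) ∷ [])

  step′ : Cf → Cf
  step′ c with step M c
  ... | nothing = c
  ... | just c' = c'

  stepWith : St → List Sy → Sy → List Sy → Maybe (St × Sy × Move) → Cf
  stepWith q ls a rs nothing = conf q ls a rs
  stepWith q ls a rs (just (q' , b , mv)) = doMove M q' ls b rs mv

  step′-δ : ∀ q ls a rs → step′ (conf q ls a rs) ≡ stepWith q ls a rs (δ q a)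
  step′-δ q ls a rs with δ q a
  ... | nothing = refl
  ... | just (q' , b , mv) = refl

  substPair : Tm → Tm → Subst sig
  substPair x y = substList (x ∷ y ∷ [])

  stepT-root : ∀ q a ls rs → stepT (Kt q a (encTape ls) (encTape rs)) ⇒* (stepRhs q a (δ q a)) ⟪ substPair (encTape ls) (encTape rs) ⟫
  stepT-root q a ls rs = rootStep (kstep q a) (substPair (encTape ls) (encTape rs)) refl refl (encConf-value (conf q ls a rs) ∷ [])

  stepRhs-simulates : ∀ q a ls rs m → stepRhs q a m ⟪ substPair (encTape ls) (encTape rs) ⟫ ⇒* encConf (stepWith q ls a rs m)
  stepRhs-simulates q a ls rs nothing = ε
  stepRhs-simulates q a [] [] (just (q' , b , stay)) = ε
  stepRhs-simulates q a [] (r ∷ rs) (just (q' , b , stay)) = ε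
  stepRhs-simulates q a (l ∷ ls) [] (just (q' , b , stay)) = ε
  stepRhs-simulates q a (l ∷ ls) (r ∷ rs) (just (q' , b , stay)) = ε
  stepRhs-simulates q a [] rs (just (q' , b , left)) =
    ⟶ᵢ*-arg (suc zero) (psh-evaluates b rs) ◅◅ rootStep (kmvLε q') (substList (encTape (b ∷ rs) ∷ [])) refl refl (eps-value ∷ encTape-value (b ∷ rs) ∷ [])
  stepRhs-simulates q a (l ∷ ls) rs (just (q' , b , left)) =
    ⟶ᵢ*-arg (suc zero) (psh-evaluates b rs) ◅◅
    rootStep (kmvL q' l) (substList (encW (bits (l ∷ ls)) ∷ encTape ls ∷ encTape (b ∷ rs) ∷ [])) refl refl (encTape-value (l ∷ ls) ∷ encTape-value (b ∷ rs) ∷ [])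
  stepRhs-simulates q a [] [] (just (q' , b , right)) =
    ⟶ᵢ*-arg (suc zero) (psh-evaluates b []) ◅◅ rootStep (kmvRε q') (substList (encTape (b ∷ []) ∷ [])) refl refl (eps-value ∷ encTape-value (b ∷ []) ∷ [])
  stepRhs-simulates q a [] (r ∷ xs) (just (q' , b , right)) =
    ⟶ᵢ*-arg (suc zero) (psh-evaluates b []) ◅◅
    rootStep (kmvR q' r) (substList (encW (bits (r ∷ xs)) ∷ encTape xs ∷ encTape (b ∷ []) ∷ [])) refl refl (encTape-value (r ∷ xs) ∷ encTape-value (b ∷ []) ∷ [])
  stepRhs-simulates q a (l ∷ ls) [] (just (q' , b , right)) =
    ⟶ᵢ*-arg (suc zero) (psh-evaluates b (l ∷ ls)) ◅◅ rootStep (kmvRε q') (substList (encTape (b ∷ (l ∷ ls)) ∷ [])) refl refl (eps-value ∷ encTape-value (b ∷ (l ∷ ls)) ∷ [])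
  stepRhs-simulates q a (l ∷ ls) (r ∷ xs) (just (q' , b , right)) =
    ⟶ᵢ*-arg (suc zero) (psh-evaluates b (l ∷ ls)) ◅◅
    rootStep (kmvR q' r) (substList (encW (bits (r ∷ xs)) ∷ encTape xs ∷ encTape (b ∷ (l ∷ ls)) ∷ [])) refl refl (encTape-value (r ∷ xs) ∷ encTape-value (b ∷ (l ∷ ls)) ∷ [])

  stepT-simulates : ∀ c → stepT (encConf c) ⇒* encConf (step′ c)
  stepT-simulates (conf q ls a rs) rewrite step′-δ q ls a rs = stepT-root q a ls rs ◅◅ stepRhs-simulates q a ls rs (δ q a)

  iter : ℕ → Cf → Cf
  iter zero c = c
  iter (suc n) c = step′ (iter n c)

  iter-+ : ∀ m n c → iter (m + n) c ≡ iter m (iter n c)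
  iter-+ zero n c = refl
  iter-+ (suc m) n c = ≡cong step′ (iter-+ m n c)

  stepTⁿ-⟪⟫ : ∀ n (σ : Subst sig) → stepTⁿ n (V 0) ⟪ σ ⟫ ≡ stepTⁿ n (σ 0)
  stepTⁿ-⟪⟫ zero σ = refl
  stepTⁿ-⟪⟫ (suc n) σ = ≡cong stepT (stepTⁿ-⟪⟫ n σ)

  stepTⁿ-simulates : ∀ n c → stepTⁿ n (encConf c) ⇒* encConf (iter n c)
  stepTⁿ-simulates zero c = ε
  stepTⁿ-simulates (suc n) c = ⟶ᵢ*-arg zero (stepTⁿ-simulates n c) ◅◅ stepT-simulates (iter n c)

  lookupℕ : ∀ {n} → Vec (List Bool) n → ℕ → List Bool
  lookupℕ [] _ = []
  lookupℕ (v ∷ vs) zero = v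
  lookupℕ (v ∷ vs) (suc m) = lookupℕ vs m

  lookupℕ-toℕ : ∀ {n} (vs : Vec (List Bool) n) i → lookupℕ vs (toℕ i) ≡ lookup vs i
  lookupℕ-toℕ (v ∷ vs) zero = refl
  lookupℕ-toℕ (v ∷ vs) (suc i) = lookupℕ-toℕ vs i

  map-encW-ε : ∀ n → Vec.map encW (replicate n []) ≡ replicate n eps
  map-encW-ε zero = refl
  map-encW-ε (suc n) = ≡cong (eps ∷_) (map-encW-ε n)

  substs′-replicate-var : ∀ n x (σ : Subst sig) → substs′ (replicate n (V x)) σ ≡ replicate n (σ x)
  substs′-replicate-var zero x σ = refl
  substs′-replicate-var (suc n) x σ = ≡cong (σ x ∷_) (substs′-replicate-var n x σ)

  encW-values : ∀ {n} (ds : Vec (List Bool) n) → VAll.All IsVal (Vec.map encW ds)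
  encW-values [] = []
  encW-values (d ∷ ds) = encW-value d ∷ encW-values ds

  module Counter (w : List Bool) where
    N : ℕ
    N = length w

    counterValue : ∀ {n} → Vec (List Bool) n → ℕ
    counterValue [] = 0
    counterValue {suc n} (d ∷ ds) = length d * suc N ^ n + counterValue ds

    incDigits : ∀ {n} → Fin n → Bool → Vec (List Bool) n → Vec (List Bool) n
    incDigits {suc n} zero b (v ∷ vs) = (b ∷ v) ∷ replicate n []
    incDigits (suc j) b (v ∷ vs) = v ∷ incDigits j b vs

    decDigits : ∀ {n} → Fin n → Vec (List Bool) n → Vec (List Bool) n
    decDigits {suc n} zero (v ∷ vs) = v ∷ replicate n w
    decDigits (suc j) (v ∷ vs) = v ∷ decDigits j vs

    zeros-or-dec : ∀ {n} (ds : Vec (List Bool) n) →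
      ds ≡ replicate n [] ⊎ Σ (Fin n) λ j → Σ Bool λ b → Σ (Vec (List Bool) n) λ vs → ds ≡ incDigits j b vs
    zeros-or-dec [] = inj₁ refl
    zeros-or-dec (d ∷ ds) with zeros-or-dec ds
    ... | inj₂ (j , b , vs , e) = inj₂ (suc j , b , d ∷ vs , ≡cong (d ∷_) e)
    zeros-or-dec ([] ∷ ds) | inj₁ e = inj₁ (≡cong ([] ∷_) e)
    zeros-or-dec ((b ∷ x) ∷ ds) | inj₁ e = inj₂ (zero , b , x ∷ ds , ≡cong ((b ∷ x) ∷_) e)

    counterValue-zeros : ∀ n → counterValue (replicate n []) ≡ 0
    counterValue-zeros zero = refl
    counterValue-zeros (suc n) = counterValue-zeros n

    counterValue-max : ∀ n → suc (counterValue (replicate n w)) ≡ suc N ^ n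
    counterValue-max zero = refl
    counterValue-max (suc n) = begin
        suc (N * suc N ^ n + counterValue (replicate n w))   ≡⟨ sym (+-suc (N * suc N ^ n) _) ⟩
        N * suc N ^ n + suc (counterValue (replicate n w))   ≡⟨ ≡cong (N * suc N ^ n +_) (counterValue-max n) ⟩
        N * suc N ^ n + suc N ^ n                  ≡⟨ +-comm (N * suc N ^ n) _ ⟩
        suc N ^ n + N * suc N ^ n                  ∎
      where open ≡-Reasoning

    counterValue-dec : ∀ {n} (j : Fin n) b vs → counterValue (incDigits j b vs) ≡ suc (counterValue (decDigits j vs))
    counterValue-dec {suc n} zero b (x ∷ vs) = begin
        (suc N ^ n + length x * suc N ^ n) + counterValue (replicate n [])  ≡⟨ ≡cong ((suc N ^ n + length x * suc N ^ n) +_) (counterValue-zeros n) ⟩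
        (suc N ^ n + length x * suc N ^ n) + 0                    ≡⟨ +-identityʳ _ ⟩
        suc N ^ n + length x * suc N ^ n                          ≡⟨ ≡cong (_+ length x * suc N ^ n) (sym (counterValue-max n)) ⟩
        suc (counterValue (replicate n w) + length x * suc N ^ n)            ≡⟨ ≡cong suc (+-comm (counterValue (replicate n w)) _) ⟩
        suc (length x * suc N ^ n + counterValue (replicate n w))            ∎
      where open ≡-Reasoning
    counterValue-dec {suc n} (suc j) b (x ∷ vs) = trans (≡cong (length x * suc N ^ n +_) (counterValue-dec j b vs)) (+-suc _ _)

    digitPats-instance : ∀ {n} (v : ℕ → ℕ) (j : Fin n) b (vs : Vec (List Bool) n) (σ : Subst sig) →
               (∀ i → σ (v (toℕ i)) ≡ encW (lookup vs i)) → substs′ (digitPats v j b) σ ≡ Vec.map encW (incDigits j b vs)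
    digitPats-instance {suc n} v zero false (x ∷ vs) σ h = cong₂ _∷_ (≡cong s0 (h zero)) (trans (substs′-replicate-ε n σ) (sym (map-encW-ε n)))
    digitPats-instance {suc n} v zero true (x ∷ vs) σ h = cong₂ _∷_ (≡cong s1 (h zero)) (trans (substs′-replicate-ε n σ) (sym (map-encW-ε n)))
    digitPats-instance {suc n} v (suc j) b (x ∷ vs) σ h = cong₂ _∷_ (h zero) (digitPats-instance (λ m → v (suc m)) j b vs σ (λ i → h (suc i)))

    digitsDecremented-instance : ∀ {n} (v : ℕ → ℕ) (j : Fin n) (vs : Vec (List Bool) n) (σ : Subst sig) →
               (∀ i → σ (v (toℕ i)) ≡ encW (lookup vs i)) → σ 1 ≡ encW w → substs′ (digitsDecremented v j) σ ≡ Vec.map encW (decDigits j vs)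
    digitsDecremented-instance {suc n} v zero (x ∷ vs) σ h h1 =
      cong₂ _∷_ (h zero) (trans (substs′-replicate-var n 1 σ) (trans (≡cong (replicate n) h1) (sym (VP.map-replicate encW w n))))
    digitsDecremented-instance {suc n} v (suc j) (x ∷ vs) σ h h1 = cong₂ _∷_ (h zero) (digitsDecremented-instance (λ m → v (suc m)) j vs σ (λ i → h (suc i)) h1)

    iterSubst : Cf → Vec (List Bool) digits → Subst sig
    iterSubst c vs zero = encConf c
    iterSubst c vs (suc zero) = encW w
    iterSubst c vs (suc (suc m)) = encW (lookupℕ vs m)

    iterSubst-digit : ∀ c vs i → iterSubst c vs (digitVar (toℕ i)) ≡ encW (lookup vs i)
    iterSubst-digit c vs i = ≡cong encW (lookupℕ-toℕ vs i)

    blockSteps-double : ∀ x → blockSteps * 2 ^ suc x ≡ blockSteps * 2 ^ x + blockSteps * 2 ^ x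
    blockSteps-double x = trans (*-distribˡ-+ blockSteps (2 ^ x) (2 ^ x + 0)) (≡cong (λ z → blockSteps * 2 ^ x + blockSteps * z) (+-identityʳ (2 ^ x)))

    iterT-runs : ∀ r (ds : Vec (List Bool) digits) → counterValue ds ≡ r → ∀ c →
           iterT (encConf c) (encW w) (Vec.map encW ds) ⇒* encConf (iter (blockSteps * 2 ^ r) c)
    iterT-runs r ds e c with zeros-or-dec ds
    iterT-runs r ds e c | inj₁ refl rewrite sym e | counterValue-zeros digits | *-identityʳ blockSteps =
      rootStep kiterε (substList (encConf c ∷ encW w ∷ [])) (≡cong (iterT (encConf c) (encW w)) (trans (map-encW-ε digits) (sym (substs′-replicate-ε digits _))))
            (stepTⁿ-⟪⟫ blockSteps _) (encConf-value c ∷ encW-value w ∷ subst (VAll.All IsVal) (sym (substs′-replicate-ε digits _)) (εs-value digits))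
      ◅◅ stepTⁿ-simulates blockSteps c
    iterT-runs zero ds e c | inj₂ (j , b , vs , refl) with trans (sym e) (counterValue-dec j b vs)
    ... | ()
    iterT-runs (suc r) ds e c | inj₂ (j , b , vs , refl) =
      rootStep (kiter j b) (iterSubst c vs) (≡cong (iterT (encConf c) (encW w)) (sym dI)) (cong₂ (λ x y → iterT (iterT (encConf c) (encW w) x) (encW w) y) rI rI)
            (encConf-value c ∷ encW-value w ∷ subst (VAll.All IsVal) (sym dI) (encW-values _))
      ◅◅ ⟶ᵢ*-arg zero (iterT-runs r ds' e' c)
      ◅◅ subst (λ z → iterT (encConf (iter (blockSteps * 2 ^ r) c)) (encW w) (Vec.map encW ds') ⇒* encConf z) cnt (iterT-runs r ds' e' (iter (blockSteps * 2 ^ r) c))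
      where
      ds' : Vec (List Bool) digits
      ds' = decDigits j vs
      dI : substs′ (digitPats digitVar j b) (iterSubst c vs) ≡ Vec.map encW (incDigits j b vs)
      dI = digitPats-instance digitVar j b vs (iterSubst c vs) (iterSubst-digit c vs)
      rI : substs′ (digitsDecremented digitVar j) (iterSubst c vs) ≡ Vec.map encW ds'
      rI = digitsDecremented-instance digitVar j vs (iterSubst c vs) (iterSubst-digit c vs) refl
      e' : counterValue ds' ≡ r
      e' = suc-injective (trans (sym (counterValue-dec j b vs)) e)
      cnt : iter (blockSteps * 2 ^ r) (iter (blockSteps * 2 ^ r) c) ≡ iter (blockSteps * 2 ^ suc r) c
      cnt = trans (sym (iter-+ (blockSteps * 2 ^ r) (blockSteps * 2 ^ r) c)) (≡cong (λ z → iter z c) (sym (blockSteps-double r)))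

  conv-evaluates : ∀ w → convT (encW w) ⇒* encTape (map (bitSym M) w)
  conv-evaluates [] = rootStep kconvε (substList []) refl refl (eps-value ∷ [])
  conv-evaluates (false ∷ w) = rootStep (kconv false) (substList (encW w ∷ [])) refl refl (encW-value (false ∷ w) ∷ []) ◅◅ ⟶ᵢ*-arg zero (conv-evaluates w) ◅◅ psh-evaluates (bitSym M false) (map (bitSym M) w)
  conv-evaluates (true ∷ w) = rootStep (kconv true) (substList (encW w ∷ [])) refl refl (encW-value (true ∷ w) ∷ []) ◅◅ ⟶ᵢ*-arg zero (conv-evaluates w) ◅◅ psh-evaluates (bitSym M true) (map (bitSym M) w)

  mk-evaluates : ∀ w → mkT (encTape (map (bitSym M) w)) ⇒* encConf (initConf M w)
  mk-evaluates [] = rootStep kmkε (substList []) refl refl (eps-value ∷ [])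
  mk-evaluates (b ∷ w) = rootStep (kmk (bitSym M b)) (substList (encW (bits (map (bitSym M) (b ∷ w))) ∷ encTape (map (bitSym M) w) ∷ [])) refl refl (encTape-value (map (bitSym M) (b ∷ w)) ∷ [])

  chk-evaluates : ∀ w → chkT (encW w) ⇒* eps
  chk-evaluates [] = rootStep kchkε (substList []) refl refl (eps-value ∷ [])
  chk-evaluates (false ∷ w) = rootStep (kchk false) (substList (encW w ∷ [])) refl refl (encW-value (false ∷ w) ∷ []) ◅◅ chk-evaluates w
  chk-evaluates (true ∷ w) = rootStep (kchk true) (substList (encW w ∷ [])) refl refl (encW-value (true ∷ w) ∷ []) ◅◅ chk-evaluates w

  out-evaluates : ∀ c → outT (encConf c) ⇒* encW (output M c)
  out-evaluates (conf q ls a rs) = rootStep (kout q a) (substList (encTape ls ∷ encTape rs ∷ [])) refl (bw-⟪⟫ a (wofT (V 1)) _) (encConf-value (conf q ls a rs) ∷ [])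
                          ◅◅ subst (bw a (wofT (encTape rs)) ⇒*_) (bw-bits a rs) (bw-⇒* a (wof-evaluates rs))

  step′-halted : ∀ c → step M c ≡ nothing → step′ c ≡ c
  step′-halted c e with step M c
  ... | nothing = refl
  step′-halted c () | just _

  step′-just : ∀ c c' → step M c ≡ just c' → step′ c ≡ c'
  step′-just c c' e with step M c
  step′-just c c' refl | just .c' = refl

  iter-halted : ∀ c → step M c ≡ nothing → ∀ n → iter n c ≡ c
  iter-halted c h zero = refl
  iter-halted c h (suc n) = trans (≡cong step′ (iter-halted c h n)) (step′-halted c h)

  iter-suc : ∀ n c → iter n (step′ c) ≡ iter (suc n) c
  iter-suc n c = trans (sym (iter-+ n 1 c)) (≡cong (λ z → iter z c) (+-comm n 1))

  run≡iter : ∀ n c → run M n c ≡ iter n c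
  run≡iter zero c = refl
  run≡iter (suc n) c with step M c in eq
  ... | nothing = sym (trans (≡cong step′ (iter-halted c eq n)) (step′-halted c eq))
  ... | just c' = trans (run≡iter n c') (trans (≡cong (iter n) (sym (step′-just c c' eq))) (iter-suc n c))

  iter-after-halt : ∀ t T c → step M (iter t c) ≡ nothing → t ≤ T → iter T c ≡ iter t c
  iter-after-halt t T c h le with m≤n⇒∃[o]m+o≡n le
  ... | d , refl = trans (≡cong (λ z → iter z c) (+-comm t d)) (trans (iter-+ d t c) (iter-halted (iter t c) h d))

  gT : Tm → Tm
  gT t = A gS (t ∷ [])

  g-evaluates : ∀ w t → step M (run M t (initConf M w)) ≡ nothing → t ≤ 2 ^ (cc * suc (length w) ^ kk) →
          gT (encW w) ⇒* encW (output M (run M t (initConf M w)))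
  g-evaluates w t h le =
    rootStep kg (substList (encW w ∷ [])) refl refl (encW-value w ∷ [])
    ◅◅ ⟶ᵢ*-arg (suc zero) (chk-evaluates w)
    ◅◅ rootStep kg′ (substList (encW w ∷ [])) refl
         (≡cong (λ z → outT (iterT (mkT (convT (encW w))) (encW w) z)) (trans (substs′-replicate-var digits 0 _) (sym (VP.map-replicate encW w digits))))
         (encW-value w ∷ eps-value ∷ [])
    ◅◅ ⟶ᵢ*-arg zero (⟶ᵢ*-arg zero (⟶ᵢ*-arg zero (conv-evaluates w) ◅◅ mk-evaluates w))
    ◅◅ ⟶ᵢ*-arg zero (Ctr.iterT-runs r0 (replicate digits w) refl c0)
    ◅◅ subst (λ z → outT (encConf (iter T0 c0)) ⇒* encW (output M z)) fin (out-evaluates (iter T0 c0))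
    where
    module Ctr = Counter w
    c0 : Cf
    c0 = initConf M w
    r0 : ℕ
    r0 = Ctr.counterValue (replicate digits w)
    T0 : ℕ
    T0 = blockSteps * 2 ^ r0
    t≤T : t ≤ T0
    t≤T = ≤-trans le (≤-trans (^-monoʳ-≤ 2 (exponent-bound cc kk (length w) r0 (Ctr.counterValue-max digits)))
                                    (≤-reflexive (^-distribˡ-+-* 2 cc r0)))
    fin : iter T0 c0 ≡ run M t c0
    fin = trans (iter-after-halt t T0 c0 (subst (λ z → step M z ≡ nothing) (run≡iter t c0) h) t≤T) (sym (run≡iter t c0))

  StuckCheck : Tm → Set
  StuckCheck v = dChk (rootClass v) ≡ nothing

  con-stuck : ∀ j (ts : Vec Tm 2) → StuckCheck (A (con j) ts)
  con-stuck j ts with splitAt (NS * NA) j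
  ... | inj₁ _ = refl
  ... | inj₂ _ = refl

  word-or-stuck : ∀ s → IsVal s → (Σ (List Bool) λ w → s ≡ encW w) ⊎ (Σ Tm λ v → StuckCheck v × (chkT s ⇒* chkT v) × IsVal v)
  word-or-stuck (V x) iv = inj₂ (V x , refl , ε , iv)
  word-or-stuck (A ε []) iv = inj₁ ([] , refl)
  word-or-stuck (A S₀ (s ∷ [])) iv@(IsValue.app _ (v ∷ [])) with word-or-stuck s v
  ... | inj₁ (w , e) = inj₁ (false ∷ w , ≡cong s0 e)
  ... | inj₂ (u , b , st , iu) = inj₂ (u , b , rootStep (kchk false) (substList (s ∷ [])) refl refl (iv ∷ []) ◅◅ st , iu)
  word-or-stuck (A S₁ (s ∷ [])) iv@(IsValue.app _ (v ∷ [])) with word-or-stuck s v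
  ... | inj₁ (w , e) = inj₁ (true ∷ w , ≡cong s1 e)
  ... | inj₂ (u , b , st , iu) = inj₂ (u , b , rootStep (kchk true) (substList (s ∷ [])) refl refl (iv ∷ []) ◅◅ st , iu)
  word-or-stuck (A (con j) ts) iv = inj₂ (A (con j) ts , con-stuck j ts , ε , iv)
  word-or-stuck (A (def i) ts) (IsValue.app () _)

  chk-stuck : ∀ v → StuckCheck v → IsVal v → ∀ {s t} → s ≡ chkT v → s ⟶' t → ⊥
  chk-stuck v bad iv eq (_⟶_.root {ρ} m σ) with ∈R⇒ruleOf m
  ... | k , refl with trans (sym (decodeKey-lhs k σ)) (trans (≡cong decodeKey eq) bad)
  ... | ()
  chk-stuck v bad iv refl (_⟶_.cong zero p) = value-irreducible iv p

  g′-stuck : ∀ s v → IsVal s → StuckCheck v → IsVal v → ∀ {s' t} → s' ≡ A g′S (s ∷ chkT v ∷ []) → s' ⟶' t → ⊥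
  g′-stuck s v is bad iv eq (_⟶_.root {ρ} m σ) with ∈R⇒ruleOf m
  ... | k , refl with trans (sym (decodeKey-lhs k σ)) (≡cong decodeKey eq)
  ... | ()
  g′-stuck s v is bad iv refl (_⟶_.cong zero p) = value-irreducible is p
  g′-stuck s v is bad iv refl (_⟶_.cong (suc zero) p) = chk-stuck v bad iv refl p

  -- On a non-word s the check gets stuck, and g(s) reaches the normal form g′(s, chk(v)),
  -- which is not a value.
  input-is-word : ∀ s → IsVal s → ∀ {t} → gT s ⇒* t → NF' t → IsVal t → (Σ (List Bool) λ w → s ≡ encW w)
  input-is-word s is {t} st nf it with word-or-stuck s is
  ... | inj₁ r = r
  ... | inj₂ (v , bad , cst , iv) with confluentR (⟶ᵢ*⇒⟶* st) (⟶ᵢ*⇒⟶* (rootStep kg (substList (s ∷ [])) refl refl (is ∷ []) ◅◅ ⟶ᵢ*-arg (suc zero) cst))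
  ... | z , p , q with trans (NF-⟶*-≡ nf p) (sym (NF-⟶*-≡ (λ u → g′-stuck s v is bad iv refl) q))
  ... | refl with it
  ... | IsValue.app () _

  RunsWithin : (List Bool → List Bool) → Set
  RunsWithin f = ∀ w → Σ ℕ λ t → t ≤ 2 ^ (cc * suc (length w) ^ kk)
    × Halted M (run M t (initConf M w)) × output M (run M t (initConf M w)) ≡ f w

  computes : ∀ f → RunsWithin f → Computes sig R f
  computes f runs = confluentR , [] , [] , zero , refl , λ s t vs vt → fwd s t , bwd s t vs vt
    where
    evalW : ∀ w → gT (encW w) ⇒* encW (f w)
    evalW w with runs w
    ... | t , le , halt , out = subst (λ z → gT (encW w) ⇒* encW z) out (g-evaluates w t halt le)
    fwd : ∀ s t → Graph sig R f s t → (_⟶ᵢ!_ sig R (gT s) t) × Accepting sig R [] t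
    fwd s t (w , refl , refl) = (evalW w , value-NF (encW-value (f w))) , []
    bwd : ∀ s t → IsVal s → IsVal t → (_⟶ᵢ!_ sig R (gT s) t) × Accepting sig R [] t → Graph sig R f s t
    bwd s t vs vt ((st , nf) , _) with input-is-word s vs st nf vt
    ... | w , refl with confluentR (⟶ᵢ*⇒⟶* st) (⟶ᵢ*⇒⟶* (evalW w))
    ... | z , p , q = w , refl , trans (NF-⟶*-≡ nf p) (sym (NF-⟶*-≡ (value-NF (encW-value (f w))) q))


theorem4 : (f : List Bool → List Bool) → FEXP f →
    Σ Signature λ Sg → Σ (List (Rule Sg)) λ R →
    ConstructorTRS Sg R × Computes Sg R f ×
    Σ (QuasiPrecedence Sg) λ P → Admissible Sg P ×
    Σ (SafeMapping Sg) λ sm → EPO.Compatible Sg P sm R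
theorem4 f (M , cc , kk , runs) =
  sig , R , constructorTRS , computes f runs , precedence , admissible , safeMap , compatible
  where
  open MachineTRS M cc kk
  open MachineOrder M cc kk
  open Simulation M cc kk
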